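{- Let $\Sigma$ be a signature of the concurrent metalanguage and let $f_1,\dots,f_k$ be fresh function symbols (not in $\Sigma$) with $f_i:A_i\to T_\nu B_i$. For each $i=1,\dots,k$ let $x:A_i\rhd p_i : T(C^i_1+\dots+C^i_{n_i})$ be a program not containing any $f_j$, and for each $j=1,\dots,n_i$ let $x:A_i,\,x_j:C^i_j\rhd p^i_j : T(T_\nu B_i+B_i)$ be a program which either contains no $f_m$ at all or is syntactically of the form $p^i_j\equiv \mathsf{ret}(\mathsf{inl}(f_m(x_j)))$ for some $m$. Consider the system of equations (a guarded corecursive scheme) $$\mathsf{out}(f_i(x)) = \mathsf{do}\ z\gets p_i;\ \mathsf{case}\ z\ \mathsf{of}\ \mathsf{inj}^{n_i}_1 x_1\mapsto p^i_1;\ \dots;\ \mathsf{inj}^{n_i}_{n_i} x_{n_i}\mapsto p^i_{n_i},\qquad i=1,\dots,k.$$ Then in every $\mathsf{ME}_\nu$-model interpreting $\Sigma$ there exist unique morphisms $g_i:[\![A_i]\!]\to R[\![B_i]\!]$ such that interpreting each $f_i$ as $g_i$ makes all these equations satisfied; moreover, these solutions are expressible in the metalanguage: there are programs $x:A_i\rhd t_i:T_\nu B_i$ over $\Sigma$ (not containing any $f_m$) such that in every model $g_i=[\![x:A_i\rhd t_i]\!]$.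
   Context: Types: $P ::= W \mid 1 \mid P\times P \mid P+P \mid TP \mid T_\nu P$ ($W$ atomic). Programs are built from variables, function symbols, $\star$, pairing/projections, $\mathsf{inl},\mathsf{inr}$ and $\mathsf{case}\ s\ \mathsf{of}\ \mathsf{inl}\,x\mapsto t;\ \mathsf{inr}\,y\mapsto u$, monadic $\mathsf{ret}\,t:TA$ and $\mathsf{do}\ x\gets p;\ q$, deadlock $\varnothing:TA$, choice $p+q:TA$, $\mathsf{out}(p):T(T_\nu A+A)$ for $p:T_\nu A$, and $\mathsf{unfold}\ x:=p\ \mathsf{in}\ q:T_\nu B$ for $p:A$, $x:A\rhd q:T(A+B)$. $n$-ary coproducts are nested binary ones: $C_1+\dots+C_n$ with injections defined by $\mathsf{inj}^1_1 p=p$, $\mathsf{inj}^{n+1}_1 p=\mathsf{inl}\,p$, $\mathsf{inj}^{n+1}_{i+1}p=\mathsf{inr}(\mathsf{inj}^n_i p)$, and the $n$-ary case construct is the corresponding nested binary case. An $\mathsf{ME}_\nu$-model is a distributive category $\mathcal C$ with a strong monad $(T,\eta,(-)^\star,\tau)$ that is semi-additive (natural $\delta:1\to T$, $\varpi:T\times T\to T$ making each $TA$ a bounded join-semilattice, with $f^\star\delta=\delta$, $f^\star\varpi=\varpi\langle f^\star,f^\star\rangle$, $\tau(f\times\delta)=\delta$, $\tau(f\times\varpi)=\varpi\langle\tau(f\times\pi_1),\tau(f\times\pi_2)\rangle$), such that each functor $T(-+A)$ has a final coalgebra $\mathsf{out}_A:RA\to T(RA+A)$; types are interpreted with $[\![TA]\!]=T[\![A]\!]$,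 $[\![T_\nu A]\!]=R[\![A]\!]$; $\mathsf{ret},\mathsf{do}$ via $\eta$, Kleisli extension and strength, $\varnothing,+$ via $\delta,\varpi$, $\mathsf{case}$ via copairing and $\mathit{dist}$, $\mathsf{out}$ via $\mathsf{out}_A$, and $[\![\mathsf{unfold}\ x:=p\ \mathsf{in}\ q]\!]=R\pi_2\circ[\![f]\!]\circ\langle\mathrm{id},[\![p]\!]\rangle$ where $[\![f]\!]$ is the unique coalgebra morphism from $f=T(\mathit{dist})\circ\tau\circ\langle\pi_1,[\![q]\!]\rangle$ into the final coalgebra. -}

module Defs where

open import Level as L using (Level; _⊔_; Setω)
open import Data.Nat using (ℕ; zero; suc)
open import Data.Fin using (Fin; zero; suc)
open import Data.Sum using (_⊎_; inj₁; inj₂)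
open import Data.Product using (_×_)
open import Function using (_∘′_)
open import Relation.Binary.Structures using (IsEquivalence)
open import Relation.Binary.PropositionalEquality using (_≡_; subst; sym)

infixr 6 _⊗_
infixr 5 _⊕_

data Ty (W : Set) : Set where
  at  : W → Ty W
  𝟙   : Ty W
  _⊗_ : Ty W → Ty W → Ty W
  _⊕_ : Ty W → Ty W → Ty W
  T   : Ty W → Ty W
  Tν  : Ty W → Ty W

record Sig : Set₁ where
  field
    Atom : Set
    Fun  : Set
    dom  : Fun → Ty Atom
    cod  : Fun → Ty Atom
open Sig public

infixl 4 _▸_
data Ctx (W : Set) : Set where
  ε   : Ctx W
  _▸_ : Ctx W → Ty W → Ctx W

infix 3 _∋_
data _∋_ {W : Set} : Ctx W → Ty W → Set where
  here  : ∀ {Γ A} → (Γ ▸ A) ∋ A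
  there : ∀ {Γ A B} → Γ ∋ A → (Γ ▸ B) ∋ A

data Tm (S : Sig) (Γ : Ctx (Atom S)) : Ty (Atom S) → Set where
  var    : ∀ {A} → Γ ∋ A → Tm S Γ A
  app    : (f : Fun S) → Tm S Γ (dom S f) → Tm S Γ (cod S f)
  ⋆      : Tm S Γ 𝟙
  pair   : ∀ {A B} → Tm S Γ A → Tm S Γ B → Tm S Γ (A ⊗ B)
  fst    : ∀ {A B} → Tm S Γ (A ⊗ B) → Tm S Γ A
  snd    : ∀ {A B} → Tm S Γ (A ⊗ B) → Tm S Γ B
  inl    : ∀ {A B} → Tm S Γ A → Tm S Γ (A ⊕ B)
  inr    : ∀ {A B} → Tm S Γ B → Tm S Γ (A ⊕ B)
  case   : ∀ {A B C} → Tm S Γ (A ⊕ B) → Tm S (Γ ▸ A) C → Tm S (Γ ▸ B) C → Tm S Γ C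
  ret    : ∀ {A} → Tm S Γ A → Tm S Γ (T A)
  bind     : ∀ {A B} → Tm S Γ (T A) → Tm S (Γ ▸ A) (T B) → Tm S Γ (T B)
  ∅      : ∀ {A} → Tm S Γ (T A)
  _⊹_    : ∀ {A} → Tm S Γ (T A) → Tm S Γ (T A) → Tm S Γ (T A)
  out    : ∀ {A} → Tm S Γ (Tν A) → Tm S Γ (T (Tν A ⊕ A))
  unfold : ∀ {A B} → Tm S Γ A → Tm S (Γ ▸ A) (T (A ⊕ B)) → Tm S Γ (Tν B)

-- renaming (needed for the nested n-ary case construct)
Ren : {W : Set} → Ctx W → Ctx W → Set
Ren Γ Δ = ∀ {A} → Γ ∋ A → Δ ∋ A

lift : ∀ {W} {Γ Δ : Ctx W} {B} → Ren Γ Δ → Ren (Γ ▸ B) (Δ ▸ B)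
lift ρ here      = here
lift ρ (there x) = there (ρ x)

ren : ∀ {S Γ Δ A} → Ren Γ Δ → Tm S Γ A → Tm S Δ A
ren ρ (var x)      = var (ρ x)
ren ρ (app f t)    = app f (ren ρ t)
ren ρ ⋆            = ⋆
ren ρ (pair t u)   = pair (ren ρ t) (ren ρ u)
ren ρ (fst t)      = fst (ren ρ t)
ren ρ (snd t)      = snd (ren ρ t)
ren ρ (inl t)      = inl (ren ρ t)
ren ρ (inr t)      = inr (ren ρ t)
ren ρ (case s t u) = case (ren ρ s) (ren (lift ρ) t) (ren (lift ρ) u)
ren ρ (ret t)      = ret (ren ρ t)
ren ρ (bind p q)     = bind (ren ρ p) (ren (lift ρ) q)
ren ρ ∅            = ∅
ren ρ (p ⊹ q)      = ren ρ p ⊹ ren ρ q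
ren ρ (out p)      = out (ren ρ p)
ren ρ (unfold p q) = unfold (ren ρ p) (ren (lift ρ) q)

-- n-ary coproducts C₁ + … + Cₙ (n ≥ 1) as nested binary ones
Sum : ∀ {W n} → (Fin (suc n) → Ty W) → Ty W
Sum {n = zero}  C = C zero
Sum {n = suc n} C = C zero ⊕ Sum (C ∘′ suc)

_↦ : ∀ {W} {Γ : Ctx W} {A} → Γ ∋ A → Ren (Γ ▸ A) Γ
(v ↦) here      = v
(v ↦) (there x) = x

-- n-ary case on a variable  z : C₁+…+Cₙ :
--   case z of inj¹ x₁ ↦ p₁; …; injⁿ xₙ ↦ pₙ
-- n = 1: inj¹₁ p = p, so this is p₁[z/x₁];
-- n+1:   case z of inl x₁ ↦ p₁; inr y ↦ (n-ary case on y of the rest)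
caseN : ∀ {S n Γ D} {C : Fin (suc n) → Ty (Atom S)} →
        Γ ∋ Sum C → ((j : Fin (suc n)) → Tm S (Γ ▸ C j) D) → Tm S Γ D
caseN {n = zero}  z ps = ren (z ↦) (ps zero)
caseN {n = suc n} z ps =
  case (var z) (ps zero) (caseN here (λ j → ren (lift there) (ps (suc j))))

ext : (S : Sig) (k : ℕ) → (Fin k → Ty (Atom S)) → (Fin k → Ty (Atom S)) → Sig
ext S k A B = record
  { Atom = Atom S
  ; Fun  = Fun S ⊎ Fin k
  ; dom  = λ { (inj₁ f) → dom S f ; (inj₂ i) → A i }
  ; cod  = λ { (inj₁ f) → cod S f ; (inj₂ i) → Tν (B i) }
  }

emb : ∀ {S k A B Γ C} → Tm S Γ C → Tm (ext S k A B) Γ C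
emb (var x)      = var x
emb (app f t)    = app (inj₁ f) (emb t)
emb ⋆            = ⋆
emb (pair t u)   = pair (emb t) (emb u)
emb (fst t)      = fst (emb t)
emb (snd t)      = snd (emb t)
emb (inl t)      = inl (emb t)
emb (inr t)      = inr (emb t)
emb (case s t u) = case (emb s) (emb t) (emb u)
emb (ret t)      = ret (emb t)
emb (bind p q)     = bind (emb p) (emb q)
emb ∅            = ∅
emb (p ⊹ q)      = emb p ⊹ emb q
emb (out p)      = out (emb p)
emb (unfold p q) = unfold (emb p) (emb q)

module Scheme (S : Sig) (k : ℕ) (A B : Fin k → Ty (Atom S)) where

  S⁺ : Sig
  S⁺ = ext S k A B

  -- a branch  x : Aᵢ, xⱼ : D ▷ pⁱⱼ : T(Tν Bᵢ + Bᵢ)  which either contains no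
  -- f_m (a program over S) or is syntactically ret(inl(f_m(xⱼ)))
  data Branch (i : Fin k) (D : Ty (Atom S)) : Set where
    plain : Tm S (ε ▸ A i ▸ D) (T (Tν (B i) ⊕ B i)) → Branch i D
    call  : (m : Fin k) → A m ≡ D → B m ≡ B i → Branch i D

  branch : ∀ {i D} → Branch i D → Tm S⁺ (ε ▸ A i ▸ D) (T (Tν (B i) ⊕ B i))
  branch (plain t) = emb t
  branch {i} {D} (call m eA eB) =
    subst (λ X → Tm S⁺ (ε ▸ A i ▸ D) (T (Tν X ⊕ B i))) eB
      (ret (inl (app (inj₂ m) (var (subst (λ Y → (ε ▸ A i ▸ D) ∋ Y) (sym eA) here)))))

  lhs : (i : Fin k) → Tm S⁺ (ε ▸ A i) (T (Tν (B i) ⊕ B i))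
  lhs i = out (app (inj₂ i) (var here))

  rhs : (n : Fin k → ℕ) (C : (i : Fin k) → Fin (suc (n i)) → Ty (Atom S)) →
        (p : (i : Fin k) → Tm S (ε ▸ A i) (T (Sum (C i)))) →
        (q : (i : Fin k) (j : Fin (suc (n i))) → Branch i (C i j)) →
        (i : Fin k) → Tm S⁺ (ε ▸ A i) (T (Tν (B i) ⊕ B i))
  rhs n C p q i = bind (emb (p i)) (caseN here (λ j → ren (lift there) (branch (q i j))))

record DistCat (o ℓ e : Level) : Set (L.suc (o ⊔ ℓ ⊔ e)) where
  infixr 9 _∘_
  infix  4 _≈_
  infixr 7 _×₀_
  infixr 6 _+₀_
  field
    Obj  : Set o
    Hom  : Obj → Obj → Set ℓ
    _≈_  : ∀ {X Y} → Hom X Y → Hom X Y → Set e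
    ≈-equiv : ∀ {X Y} → IsEquivalence (_≈_ {X} {Y})
    id   : ∀ {X} → Hom X X
    _∘_  : ∀ {X Y Z} → Hom Y Z → Hom X Y → Hom X Z
    assoc : ∀ {X Y Z V} {f : Hom X Y} {g : Hom Y Z} {h : Hom Z V} →
            (h ∘ g) ∘ f ≈ h ∘ (g ∘ f)
    identityˡ : ∀ {X Y} {f : Hom X Y} → id ∘ f ≈ f
    identityʳ : ∀ {X Y} {f : Hom X Y} → f ∘ id ≈ f
    ∘-resp-≈  : ∀ {X Y Z} {f h : Hom Y Z} {g i : Hom X Y} →
                f ≈ h → g ≈ i → f ∘ g ≈ h ∘ i
    ⊤ : Obj
    ! : ∀ {X} → Hom X ⊤
    !-unique : ∀ {X} (f : Hom X ⊤) → f ≈ !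
    _×₀_ : Obj → Obj → Obj
    π₁ : ∀ {X Y} → Hom (X ×₀ Y) X
    π₂ : ∀ {X Y} → Hom (X ×₀ Y) Y
    ⟨_,_⟩ : ∀ {X Y Z} → Hom Z X → Hom Z Y → Hom Z (X ×₀ Y)
    project₁ : ∀ {X Y Z} {f : Hom Z X} {g : Hom Z Y} → π₁ ∘ ⟨ f , g ⟩ ≈ f
    project₂ : ∀ {X Y Z} {f : Hom Z X} {g : Hom Z Y} → π₂ ∘ ⟨ f , g ⟩ ≈ g
    ⟨⟩-unique : ∀ {X Y Z} {f : Hom Z X} {g : Hom Z Y} {h : Hom Z (X ×₀ Y)} →
                π₁ ∘ h ≈ f → π₂ ∘ h ≈ g → h ≈ ⟨ f , g ⟩
    ⊥₀ : Obj
    ¡ : ∀ {X} → Hom ⊥₀ X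
    ¡-unique : ∀ {X} (f : Hom ⊥₀ X) → f ≈ ¡
    _+₀_ : Obj → Obj → Obj
    i₁ : ∀ {X Y} → Hom X (X +₀ Y)
    i₂ : ∀ {X Y} → Hom Y (X +₀ Y)
    [_,_] : ∀ {X Y Z} → Hom X Z → Hom Y Z → Hom (X +₀ Y) Z
    inject₁ : ∀ {X Y Z} {f : Hom X Z} {g : Hom Y Z} → [ f , g ] ∘ i₁ ≈ f
    inject₂ : ∀ {X Y Z} {f : Hom X Z} {g : Hom Y Z} → [ f , g ] ∘ i₂ ≈ g
    []-unique : ∀ {X Y Z} {f : Hom X Z} {g : Hom Y Z} {h : Hom (X +₀ Y) Z} →
                h ∘ i₁ ≈ f → h ∘ i₂ ≈ g → h ≈ [ f , g ]
    -- distributivity: the canonical maps  X×Y + X×Z → X×(Y+Z)  and  0 → X×0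
    -- are isomorphisms
    dist : ∀ {X Y Z} → Hom (X ×₀ (Y +₀ Z)) ((X ×₀ Y) +₀ (X ×₀ Z))
    dist-iso₁ : ∀ {X Y Z} →
      dist ∘ [ ⟨ π₁ , i₁ ∘ π₂ ⟩ , ⟨ π₁ , i₂ ∘ π₂ ⟩ ] ≈ id {(X ×₀ Y) +₀ (X ×₀ Z)}
    dist-iso₂ : ∀ {X Y Z} →
      [ ⟨ π₁ , i₁ ∘ π₂ ⟩ , ⟨ π₁ , i₂ ∘ π₂ ⟩ ] ∘ dist ≈ id {X ×₀ (Y +₀ Z)}
    dist-zero : ∀ {X} → ¡ ∘ π₂ ≈ id {X ×₀ ⊥₀}

module DistCatOps {o ℓ e} (𝒞 : DistCat o ℓ e) where
  open DistCat 𝒞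

  infixr 8 _⁂_ _⊞_
  _⁂_ : ∀ {X Y X′ Y′} → Hom X X′ → Hom Y Y′ → Hom (X ×₀ Y) (X′ ×₀ Y′)
  f ⁂ g = ⟨ f ∘ π₁ , g ∘ π₂ ⟩

  _⊞_ : ∀ {X Y X′ Y′} → Hom X X′ → Hom Y Y′ → Hom (X +₀ Y) (X′ +₀ Y′)
  f ⊞ g = [ i₁ ∘ f , i₂ ∘ g ]

  α : ∀ {X Y Z} → Hom ((X ×₀ Y) ×₀ Z) (X ×₀ (Y ×₀ Z))
  α = ⟨ π₁ ∘ π₁ , ⟨ π₂ ∘ π₁ , π₂ ⟩ ⟩

-- ME_ν-structure on a distributive category: strong monad (Kleisli
-- triple form), semi-additivity, final coalgebras of T(- + X)

record MEν {o ℓ e} (𝒞 : DistCat o ℓ e) : Set (o ⊔ ℓ ⊔ e) where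
  open DistCat 𝒞
  open DistCatOps 𝒞
  infix 10 _*
  field
    T₀ : Obj → Obj
    η  : ∀ {X} → Hom X (T₀ X)
    _* : ∀ {X Y} → Hom X (T₀ Y) → Hom (T₀ X) (T₀ Y)
    *-resp-≈ : ∀ {X Y} {f g : Hom X (T₀ Y)} → f ≈ g → f * ≈ g *
    η* : ∀ {X} → η {X} * ≈ id
    *η : ∀ {X Y} {f : Hom X (T₀ Y)} → f * ∘ η ≈ f
    ** : ∀ {X Y Z} {f : Hom X (T₀ Y)} {g : Hom Y (T₀ Z)} → g * ∘ f * ≈ (g * ∘ f) *
    τ : ∀ {X Y} → Hom (X ×₀ T₀ Y) (T₀ (X ×₀ Y))
    τ-nat : ∀ {X Y X′ Y′} {f : Hom X X′} {g : Hom Y Y′} →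
            τ ∘ (f ⁂ (η ∘ g) *) ≈ (η ∘ (f ⁂ g)) * ∘ τ
    τ-unit : ∀ {X} → (η ∘ π₂) * ∘ τ {⊤} {X} ≈ π₂
    τ-assoc : ∀ {X Y Z} →
              (η ∘ α) * ∘ τ {X ×₀ Y} {Z} ≈ τ ∘ (id ⁂ τ) ∘ α
    τ-η : ∀ {X Y} → τ ∘ (id ⁂ η) ≈ η {X ×₀ Y}
    τ-* : ∀ {X Y Z} {f : Hom Y (T₀ Z)} →
          τ {X} ∘ (id ⁂ f *) ≈ (τ ∘ (id ⁂ f)) * ∘ τ
    δ : ∀ {X} → Hom ⊤ (T₀ X)
    ϖ : ∀ {X} → Hom (T₀ X ×₀ T₀ X) (T₀ X)
    ϖ-assoc : ∀ {Z X} {a b c : Hom Z (T₀ X)} →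
              ϖ ∘ ⟨ ϖ ∘ ⟨ a , b ⟩ , c ⟩ ≈ ϖ ∘ ⟨ a , ϖ ∘ ⟨ b , c ⟩ ⟩
    ϖ-comm  : ∀ {Z X} {a b : Hom Z (T₀ X)} → ϖ ∘ ⟨ a , b ⟩ ≈ ϖ ∘ ⟨ b , a ⟩
    ϖ-idem  : ∀ {Z X} {a : Hom Z (T₀ X)} → ϖ ∘ ⟨ a , a ⟩ ≈ a
    ϖ-unit  : ∀ {Z X} {a : Hom Z (T₀ X)} → ϖ ∘ ⟨ δ ∘ ! , a ⟩ ≈ a
    δ-nat   : ∀ {X Y} {f : Hom X Y} → (η ∘ f) * ∘ δ ≈ δ
    ϖ-nat   : ∀ {X Y} {f : Hom X Y} →
              (η ∘ f) * ∘ ϖ ≈ ϖ ∘ ((η ∘ f) * ⁂ (η ∘ f) *)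
    *-δ     : ∀ {X Y} {f : Hom X (T₀ Y)} → f * ∘ δ ≈ δ
    *-ϖ     : ∀ {X Y} {f : Hom X (T₀ Y)} → f * ∘ ϖ ≈ ϖ ∘ (f * ⁂ f *)
    τ-δ     : ∀ {Z X Y} {f : Hom Z X} → τ {X} {Y} ∘ (f ⁂ δ) ≈ δ ∘ !
    τ-ϖ     : ∀ {Z X Y} {f : Hom Z X} →
              τ {X} {Y} ∘ (f ⁂ ϖ) ≈ ϖ ∘ ⟨ τ ∘ (f ⁂ π₁) , τ ∘ (f ⁂ π₂) ⟩
    R    : Obj → Obj
    outR : ∀ {X} → Hom (R X) (T₀ (R X +₀ X))
    coit : ∀ {Z X} → Hom Z (T₀ (Z +₀ X)) → Hom Z (R X)
    coit-hom : ∀ {Z X} {c : Hom Z (T₀ (Z +₀ X))} →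
               outR ∘ coit c ≈ (η ∘ (coit c ⊞ id)) * ∘ c
    coit-unique : ∀ {Z X} {c : Hom Z (T₀ (Z +₀ X))} {h : Hom Z (R X)} →
                  outR ∘ h ≈ (η ∘ (h ⊞ id)) * ∘ c → h ≈ coit c

record Structure (W : Set) (o ℓ e : Level) : Set (L.suc (o ⊔ ℓ ⊔ e)) where
  field
    cat  : DistCat o ℓ e
    me   : MEν cat
    atom : W → DistCat.Obj cat
  open DistCat cat public
  open DistCatOps cat public
  open MEν me public

  ⟦_⟧ty : Ty W → Obj
  ⟦ at w ⟧ty  = atom w
  ⟦ 𝟙 ⟧ty     = ⊤
  ⟦ X ⊗ Y ⟧ty = ⟦ X ⟧ty ×₀ ⟦ Y ⟧ty
  ⟦ X ⊕ Y ⟧ty = ⟦ X ⟧ty +₀ ⟦ Y ⟧ty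
  ⟦ T X ⟧ty   = T₀ ⟦ X ⟧ty
  ⟦ Tν X ⟧ty  = R ⟦ X ⟧ty

  ⟦_⟧cx : Ctx W → Obj
  ⟦ ε ⟧cx     = ⊤
  ⟦ Γ ▸ X ⟧cx = ⟦ Γ ⟧cx ×₀ ⟦ X ⟧ty

  Rmap : ∀ {X Y} → Hom X Y → Hom (R X) (R Y)
  Rmap g = coit ((η ∘ (id ⊞ g)) * ∘ outR)

record Model (S : Sig) (o ℓ e : Level) : Set (L.suc (o ⊔ ℓ ⊔ e)) where
  field
    str : Structure (Atom S) o ℓ e
  open Structure str public
  field
    fun : (f : Fun S) → Hom ⟦ dom S f ⟧ty ⟦ cod S f ⟧ty

  ⟦_⟧var : ∀ {Γ X} → Γ ∋ X → Hom ⟦ Γ ⟧cx ⟦ X ⟧ty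
  ⟦ here ⟧var    = π₂
  ⟦ there x ⟧var = ⟦ x ⟧var ∘ π₁

  ⟦_⟧ : ∀ {Γ X} → Tm S Γ X → Hom ⟦ Γ ⟧cx ⟦ X ⟧ty
  ⟦ var x ⟧      = ⟦ x ⟧var
  ⟦ app f t ⟧    = fun f ∘ ⟦ t ⟧
  ⟦ ⋆ ⟧          = !
  ⟦ pair t u ⟧   = ⟨ ⟦ t ⟧ , ⟦ u ⟧ ⟩
  ⟦ fst t ⟧      = π₁ ∘ ⟦ t ⟧
  ⟦ snd t ⟧      = π₂ ∘ ⟦ t ⟧
  ⟦ inl t ⟧      = i₁ ∘ ⟦ t ⟧
  ⟦ inr t ⟧      = i₂ ∘ ⟦ t ⟧
  ⟦ case s t u ⟧ = [ ⟦ t ⟧ , ⟦ u ⟧ ] ∘ dist ∘ ⟨ id , ⟦ s ⟧ ⟩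
  ⟦ ret t ⟧      = η ∘ ⟦ t ⟧
  ⟦ bind p q ⟧   = ⟦ q ⟧ * ∘ τ ∘ ⟨ id , ⟦ p ⟧ ⟩
  ⟦ ∅ ⟧          = δ ∘ !
  ⟦ p ⊹ q ⟧      = ϖ ∘ ⟨ ⟦ p ⟧ , ⟦ q ⟧ ⟩
  ⟦ out p ⟧      = outR ∘ ⟦ p ⟧
  ⟦ unfold p q ⟧ = Rmap π₂ ∘ coit ((η ∘ dist) * ∘ τ ∘ ⟨ π₁ , ⟦ q ⟧ ⟩) ∘ ⟨ id , ⟦ p ⟧ ⟩

  -- a program  x : X ▷ t : Y  in a one-variable context, as a morphism
  -- ⟦X⟧ → ⟦Y⟧ (precomposing with the canonical iso ⟦X⟧ ≅ 1 × ⟦X⟧)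
  ⟦_⟧₁ : ∀ {X Y} → Tm S (ε ▸ X) Y → Hom ⟦ X ⟧ty ⟦ Y ⟧ty
  ⟦ t ⟧₁ = ⟦ t ⟧ ∘ ⟨ ! , id ⟩

extModel : ∀ {S k A B o ℓ e} (M : Model S o ℓ e) →
           ((i : Fin k) → Structure.Hom (Model.str M)
                             (Structure.⟦_⟧ty (Model.str M) (A i))
                             (Structure.R (Model.str M) (Structure.⟦_⟧ty (Model.str M) (B i)))) →
           Model (ext S k A B) o ℓ e
extModel M g = record
  { str = Model.str M
  ; fun = λ { (inj₁ f) → Model.fun M f ; (inj₂ i) → g i }
  }

Solves : ∀ {S k A B o ℓ e} (M : Model S o ℓ e) (n : Fin k → ℕ)
         (C : (i : Fin k) → Fin (suc (n i)) → Ty (Atom S))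
         (p : (i : Fin k) → Tm S (ε ▸ A i) (T (Sum (C i))))
         (q : (i : Fin k) (j : Fin (suc (n i))) → Scheme.Branch S k A B i (C i j)) →
         ((i : Fin k) → Structure.Hom (Model.str M)
                           (Structure.⟦_⟧ty (Model.str M) (A i))
                           (Structure.R (Model.str M) (Structure.⟦_⟧ty (Model.str M) (B i)))) →
         Set e
Solves {S} {k} {A} {B} M n C p q g =
  (i : Fin k) → Model._≈_ M⁺ (Model.⟦_⟧ M⁺ (Scheme.lhs S k A B i))
                             (Model.⟦_⟧ M⁺ (Scheme.rhs S k A B n C p q i))
  where M⁺ = extModel M g

record ΣωSet (X : Set) (P : X → Setω) : Setω where
  constructor _,_
  field
    witness : X
    proof   : P witness

-- For a fixed i, every symbol f_m reachable from fᵢ through calls has result type Bᵢ,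
-- so the equations of these symbols form a single coalgebra on  Tν Bᵢ + A₁ + … + Aₖ:
-- a call  ret (inl (f_m xⱼ))  is a jump to the state A_m, every other branch continues
-- in Tν Bᵢ (which behaves as out), and the unreachable states deadlock.  Its coiteration
-- started in the state Aᵢ is an unfold, hence a program tᵢ.  It solves the scheme by the
-- coalgebra law; conversely any solution, extended by the identity on Tν Bᵢ, is a
-- coalgebra morphism into the final coalgebra and therefore equals the coiteration.
module Submission where

open import Defs
open import Level using (Level)
open import Data.Nat using (ℕ; zero; suc)
open import Data.Fin using (Fin; zero; suc; _≟_)
open import Data.Fin.Properties using (any?)
open import Data.Fin.Subset using (Subset; _∈_; _∉_; _⊆_; _⊃_; ⁅_⁆; _∪_)
open import Data.Fin.Subset.Properties using (_∈?_; x∈⁅x⁆; x∈⁅y⁆⇒x≡y; x∈p∪q⁺; x∈p∪q⁻; q⊆p∪q)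
open import Data.Fin.Subset.Induction using (⊃-wellFounded; Acc; acc)
open import Data.Product using (_×_; _,_; ∃-syntax)
open import Data.Sum using (inj₁; inj₂)
open import Data.Empty using (⊥; ⊥-elim)
open import Function using (_∘′_)
open import Function.Bundles using (_⇔_; mk⇔; Equivalence)
open import Relation.Nullary using (Dec; yes; no)
open import Relation.Nullary.Decidable using (_×-dec_; ¬?; decidable-stable)
open import Relation.Binary.Structures using (IsEquivalence)
open import Relation.Binary.Construct.Closure.ReflexiveTransitive using (Star; _◅_; _◅◅_)
  renaming (ε to []⋆)
open import Relation.Binary.PropositionalEquality as ≡ using (_≡_; refl; sym; trans; subst; trans-reflʳ)
open import Axiom.UniquenessOfIdentityProofs.WithK using (uip)

module Categorical {W : Set} {o ℓ e : Level} (𝕊 : Structure W o ℓ e) where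
  open Structure 𝕊

  module ≈ {X Y} = IsEquivalence (≈-equiv {X} {Y})

  infix  1 begin_
  infixr 2 _≈⟨_⟩_
  infix  3 _∎
  infixr 4 _⟩∘⟨_ refl⟩∘⟨_
  infixl 5 _⟩∘⟨refl

  begin_ : ∀ {X Y} {f g : Hom X Y} → f ≈ g → f ≈ g
  begin p = p

  _≈⟨_⟩_ : ∀ {X Y} (f : Hom X Y) {g h : Hom X Y} → f ≈ g → g ≈ h → f ≈ h
  f ≈⟨ p ⟩ q = ≈.trans p q

  _∎ : ∀ {X Y} (f : Hom X Y) → f ≈ f
  f ∎ = ≈.refl

  _⟩∘⟨_ : ∀ {X Y Z} {f h : Hom Y Z} {g i : Hom X Y} → f ≈ h → g ≈ i → f ∘ g ≈ h ∘ i
  _⟩∘⟨_ = ∘-resp-≈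

  refl⟩∘⟨_ : ∀ {X Y Z} {f : Hom Y Z} {g i : Hom X Y} → g ≈ i → f ∘ g ≈ f ∘ i
  refl⟩∘⟨ p = ∘-resp-≈ ≈.refl p

  _⟩∘⟨refl : ∀ {X Y Z} {f h : Hom Y Z} {g : Hom X Y} → f ≈ h → f ∘ g ≈ h ∘ g
  p ⟩∘⟨refl = ∘-resp-≈ p ≈.refl

  sym-assoc : ∀ {X Y Z V} {f : Hom X Y} {g : Hom Y Z} {h : Hom Z V} →
              h ∘ (g ∘ f) ≈ (h ∘ g) ∘ f
  sym-assoc = ≈.sym assoc

  ×-ext : ∀ {X Y Z} {f g : Hom Z (X ×₀ Y)} → π₁ ∘ f ≈ π₁ ∘ g → π₂ ∘ f ≈ π₂ ∘ g → f ≈ g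
  ×-ext p q = ≈.trans (⟨⟩-unique p q) (≈.sym (⟨⟩-unique ≈.refl ≈.refl))

  ⟨⟩-cong₂ : ∀ {X Y Z} {f f′ : Hom Z X} {g g′ : Hom Z Y} →
             f ≈ f′ → g ≈ g′ → ⟨ f , g ⟩ ≈ ⟨ f′ , g′ ⟩
  ⟨⟩-cong₂ p q = ⟨⟩-unique (≈.trans project₁ p) (≈.trans project₂ q)

  ⟨⟩∘ : ∀ {X Y Z V} {f : Hom Z X} {g : Hom Z Y} {h : Hom V Z} →
        ⟨ f , g ⟩ ∘ h ≈ ⟨ f ∘ h , g ∘ h ⟩
  ⟨⟩∘ = ⟨⟩-unique (≈.trans sym-assoc (project₁ ⟩∘⟨refl))
                  (≈.trans sym-assoc (project₂ ⟩∘⟨refl))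

  ×-η : ∀ {X Y} → ⟨ π₁ , π₂ ⟩ ≈ id {X ×₀ Y}
  ×-η = ≈.sym (⟨⟩-unique identityʳ identityʳ)

  !-unique₂ : ∀ {X} {f g : Hom X ⊤} → f ≈ g
  !-unique₂ = ≈.trans (!-unique _) (≈.sym (!-unique _))

  ⁂∘⟨⟩ : ∀ {X Y X′ Y′ Z} {f : Hom X X′} {g : Hom Y Y′} {a : Hom Z X} {b : Hom Z Y} →
         (f ⁂ g) ∘ ⟨ a , b ⟩ ≈ ⟨ f ∘ a , g ∘ b ⟩
  ⁂∘⟨⟩ = ≈.trans ⟨⟩∘ (⟨⟩-cong₂ (≈.trans assoc (refl⟩∘⟨ project₁))
                                (≈.trans assoc (refl⟩∘⟨ project₂)))

  ⁂∘⁂ : ∀ {X Y X′ Y′ X″ Y″} {f : Hom X′ X″} {g : Hom Y′ Y″} {f′ : Hom X X′} {g′ : Hom Y Y′} →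
        (f ⁂ g) ∘ (f′ ⁂ g′) ≈ (f ∘ f′) ⁂ (g ∘ g′)
  ⁂∘⁂ = ≈.trans ⁂∘⟨⟩ (⟨⟩-cong₂ sym-assoc sym-assoc)

  id⁂id : ∀ {X Y} → id {X} ⁂ id {Y} ≈ id
  id⁂id = ≈.trans (⟨⟩-cong₂ identityˡ identityˡ) ×-η

  ⟨id,⟩∘ : ∀ {X Y Z} {s : Hom X Y} {f : Hom Z X} →
           ⟨ id , s ⟩ ∘ f ≈ (f ⁂ id) ∘ ⟨ id , s ∘ f ⟩
  ⟨id,⟩∘ = ≈.trans ⟨⟩∘ (≈.trans (⟨⟩-cong₂ (≈.trans identityˡ (≈.sym identityʳ)) (≈.sym identityˡ))
                                (≈.sym ⁂∘⟨⟩))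

  ⟨!,id⟩∘ : ∀ {X Y} {f : Hom X Y} → ⟨ ! , id ⟩ ∘ f ≈ (id ⁂ f) ∘ ⟨ ! , id ⟩
  ⟨!,id⟩∘ = ≈.trans ⟨⟩∘ (≈.trans (⟨⟩-cong₂ (≈.trans !-unique₂ (≈.sym identityˡ))
                                           (≈.trans identityˡ (≈.sym identityʳ)))
                                  (≈.sym ⁂∘⟨⟩))

  ⟨!,id⟩∘π₂ : ∀ {X} → ⟨ ! , id ⟩ ∘ π₂ ≈ id {⊤ ×₀ X}
  ⟨!,id⟩∘π₂ = ×-ext (≈.trans sym-assoc (≈.trans (project₁ ⟩∘⟨refl) !-unique₂))
                    (≈.trans sym-assoc (≈.trans (project₂ ⟩∘⟨refl)
                                               (≈.trans identityˡ (≈.sym identityʳ))))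

  π₁⁂id∘⟨id⁂f,π₂⟩ : ∀ {X Y Z} {f : Hom Y Z} → (π₁ ⁂ id) ∘ ⟨ id {X} ⁂ f , π₂ ⟩ ≈ id
  π₁⁂id∘⟨id⁂f,π₂⟩ = ≈.trans ⁂∘⟨⟩ (≈.trans (⟨⟩-cong₂ (≈.trans project₁ identityˡ) identityˡ) ×-η)

  +-ext : ∀ {X Y Z} {f g : Hom (X +₀ Y) Z} → f ∘ i₁ ≈ g ∘ i₁ → f ∘ i₂ ≈ g ∘ i₂ → f ≈ g
  +-ext p q = ≈.trans ([]-unique p q) (≈.sym ([]-unique ≈.refl ≈.refl))

  []-cong₂ : ∀ {X Y Z} {f f′ : Hom X Z} {g g′ : Hom Y Z} →
             f ≈ f′ → g ≈ g′ → [ f , g ] ≈ [ f′ , g′ ]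
  []-cong₂ p q = []-unique (≈.trans inject₁ p) (≈.trans inject₂ q)

  ∘[] : ∀ {X Y Z V} {f : Hom X Z} {g : Hom Y Z} {h : Hom Z V} →
        h ∘ [ f , g ] ≈ [ h ∘ f , h ∘ g ]
  ∘[] = []-unique (≈.trans assoc (refl⟩∘⟨ inject₁)) (≈.trans assoc (refl⟩∘⟨ inject₂))

  []∘⊞ : ∀ {X Y X′ Y′ Z} {f : Hom X′ Z} {g : Hom Y′ Z} {h : Hom X X′} {k : Hom Y Y′} →
         [ f , g ] ∘ (h ⊞ k) ≈ [ f ∘ h , g ∘ k ]
  []∘⊞ = ≈.trans ∘[] ([]-cong₂ (≈.trans sym-assoc (inject₁ ⟩∘⟨refl))
                               (≈.trans sym-assoc (inject₂ ⟩∘⟨refl)))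

  ⊞-cong₂ : ∀ {X Y X′ Y′} {f f′ : Hom X X′} {g g′ : Hom Y Y′} →
            f ≈ f′ → g ≈ g′ → f ⊞ g ≈ f′ ⊞ g′
  ⊞-cong₂ p q = []-cong₂ (refl⟩∘⟨ p) (refl⟩∘⟨ q)

  ⊞∘⊞ : ∀ {X Y X′ Y′ X″ Y″} {f : Hom X′ X″} {g : Hom Y′ Y″} {f′ : Hom X X′} {g′ : Hom Y Y′} →
        (f ⊞ g) ∘ (f′ ⊞ g′) ≈ (f ∘ f′) ⊞ (g ∘ g′)
  ⊞∘⊞ = ≈.trans []∘⊞ ([]-cong₂ assoc assoc)

  id⊞id : ∀ {X Y} → id {X} ⊞ id {Y} ≈ id
  id⊞id = +-ext (≈.trans inject₁ (≈.trans identityʳ (≈.sym identityˡ)))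
                (≈.trans inject₂ (≈.trans identityʳ (≈.sym identityˡ)))

  dist⁻¹ : ∀ {X Y Z} → Hom ((X ×₀ Y) +₀ (X ×₀ Z)) (X ×₀ (Y +₀ Z))
  dist⁻¹ = [ ⟨ π₁ , i₁ ∘ π₂ ⟩ , ⟨ π₁ , i₂ ∘ π₂ ⟩ ]

  cancel-dist⁻¹ : ∀ {X Y Z V} {f g : Hom (X ×₀ (Y +₀ Z)) V} → f ∘ dist⁻¹ ≈ g ∘ dist⁻¹ → f ≈ g
  cancel-dist⁻¹ {f = f} {g} p = begin
    f                    ≈⟨ ≈.sym (≈.trans (refl⟩∘⟨ dist-iso₂) identityʳ) ⟩
    f ∘ (dist⁻¹ ∘ dist)  ≈⟨ sym-assoc ⟩
    (f ∘ dist⁻¹) ∘ dist  ≈⟨ p ⟩∘⟨refl ⟩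
    (g ∘ dist⁻¹) ∘ dist  ≈⟨ assoc ⟩
    g ∘ (dist⁻¹ ∘ dist)  ≈⟨ ≈.trans (refl⟩∘⟨ dist-iso₂) identityʳ ⟩
    g                    ∎

  dist-i₁ : ∀ {V X Y Z} {a : Hom V X} {b : Hom V Y} →
            dist ∘ ⟨ a , i₁ {Y} {Z} ∘ b ⟩ ≈ i₁ ∘ ⟨ a , b ⟩
  dist-i₁ = begin
    dist ∘ ⟨ _ , i₁ ∘ _ ⟩           ≈⟨ refl⟩∘⟨ ≈.sym (≈.trans sym-assoc (≈.trans (inject₁ ⟩∘⟨refl)
                                         (≈.trans ⟨⟩∘ (⟨⟩-cong₂ project₁ (≈.trans assoc (refl⟩∘⟨ project₂)))))) ⟩
    dist ∘ (dist⁻¹ ∘ (i₁ ∘ ⟨ _ , _ ⟩)) ≈⟨ ≈.trans sym-assoc (≈.trans (dist-iso₁ ⟩∘⟨refl) identityˡ) ⟩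
    i₁ ∘ ⟨ _ , _ ⟩                  ∎

  dist-i₂ : ∀ {V X Y Z} {a : Hom V X} {b : Hom V Z} →
            dist ∘ ⟨ a , i₂ {Y} {Z} ∘ b ⟩ ≈ i₂ ∘ ⟨ a , b ⟩
  dist-i₂ = begin
    dist ∘ ⟨ _ , i₂ ∘ _ ⟩           ≈⟨ refl⟩∘⟨ ≈.sym (≈.trans sym-assoc (≈.trans (inject₂ ⟩∘⟨refl)
                                         (≈.trans ⟨⟩∘ (⟨⟩-cong₂ project₁ (≈.trans assoc (refl⟩∘⟨ project₂)))))) ⟩
    dist ∘ (dist⁻¹ ∘ (i₂ ∘ ⟨ _ , _ ⟩)) ≈⟨ ≈.trans sym-assoc (≈.trans (dist-iso₁ ⟩∘⟨refl) identityˡ) ⟩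
    i₂ ∘ ⟨ _ , _ ⟩                  ∎

  dist-natˡ : ∀ {X X′ Y Z} {f : Hom X X′} →
              dist ∘ (f ⁂ id {Y +₀ Z}) ≈ ((f ⁂ id) ⊞ (f ⁂ id)) ∘ dist
  dist-natˡ {f = f} = cancel-dist⁻¹ (begin
    (dist ∘ (f ⁂ id)) ∘ dist⁻¹                                       ≈⟨ ≈.trans assoc (≈.trans (refl⟩∘⟨ ∘[]) ∘[]) ⟩
    [ dist ∘ ((f ⁂ id) ∘ ⟨ π₁ , i₁ ∘ π₂ ⟩) , dist ∘ ((f ⁂ id) ∘ ⟨ π₁ , i₂ ∘ π₂ ⟩) ]
      ≈⟨ []-cong₂ (≈.trans (refl⟩∘⟨ ⁂∘⟨⟩) (≈.trans (refl⟩∘⟨ ⟨⟩-cong₂ ≈.refl identityˡ) dist-i₁))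
                  (≈.trans (refl⟩∘⟨ ⁂∘⟨⟩) (≈.trans (refl⟩∘⟨ ⟨⟩-cong₂ ≈.refl identityˡ) dist-i₂)) ⟩
    [ i₁ ∘ ⟨ f ∘ π₁ , π₂ ⟩ , i₂ ∘ ⟨ f ∘ π₁ , π₂ ⟩ ]                      ≈⟨ []-cong₂ (refl⟩∘⟨ fst⁂id) (refl⟩∘⟨ fst⁂id) ⟩
    [ i₁ ∘ (f ⁂ id) , i₂ ∘ (f ⁂ id) ]                                  ≈⟨ ≈.sym (≈.trans assoc (≈.trans (refl⟩∘⟨ dist-iso₁) identityʳ)) ⟩
    (((f ⁂ id) ⊞ (f ⁂ id)) ∘ dist) ∘ dist⁻¹                           ∎)
    where
    fst⁂id : ∀ {Y} → ⟨ f ∘ π₁ , π₂ ⟩ ≈ f ⁂ id {Y}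
    fst⁂id = ⟨⟩-cong₂ ≈.refl (≈.sym identityˡ)

  π₂⊞π₂∘dist : ∀ {X Y Z} → (π₂ ⊞ π₂) ∘ dist ≈ π₂ {X} {Y +₀ Z}
  π₂⊞π₂∘dist = cancel-dist⁻¹ (≈.trans assoc (≈.trans (refl⟩∘⟨ dist-iso₁) (≈.trans identityʳ
     (≈.sym (≈.trans ∘[] ([]-cong₂ project₂ project₂))))))

  T₁ : ∀ {X Y} → Hom X Y → Hom (T₀ X) (T₀ Y)
  T₁ f = (η ∘ f) *

  *∘η : ∀ {X Y Z} {f : Hom X (T₀ Y)} {g : Hom Z X} → f * ∘ (η ∘ g) ≈ f ∘ g
  *∘η = ≈.trans sym-assoc (*η ⟩∘⟨refl)

  *∘* : ∀ {X Y Z V} {f : Hom X (T₀ Y)} {g : Hom Y (T₀ Z)} {h : Hom V (T₀ X)} →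
        g * ∘ (f * ∘ h) ≈ (g * ∘ f) * ∘ h
  *∘* = ≈.trans sym-assoc (** ⟩∘⟨refl)

  *∘T₁ : ∀ {X Y Z} {f : Hom Y (T₀ Z)} {g : Hom X Y} → f * ∘ T₁ g ≈ (f ∘ g) *
  *∘T₁ = ≈.trans ** (*-resp-≈ *∘η)

  *∘δ∘! : ∀ {X Y V} {f : Hom X (T₀ Y)} → f * ∘ (δ ∘ ! {V}) ≈ δ ∘ !
  *∘δ∘! = ≈.trans sym-assoc (*-δ ⟩∘⟨refl)

  T₁-id : ∀ {X} → T₁ (id {X}) ≈ id
  T₁-id = ≈.trans (*-resp-≈ identityʳ) η*

  T₁-∘ : ∀ {X Y Z} {f : Hom Y Z} {g : Hom X Y} → T₁ f ∘ T₁ g ≈ T₁ (f ∘ g)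
  T₁-∘ = ≈.trans *∘T₁ (*-resp-≈ assoc)

  τ-natˡ : ∀ {X X′ Y} {f : Hom X X′} → τ {X′} {Y} ∘ (f ⁂ id) ≈ T₁ (f ⁂ id) ∘ τ
  τ-natˡ = ≈.trans (refl⟩∘⟨ ⟨⟩-cong₂ ≈.refl (≈.sym T₁-id ⟩∘⟨refl)) τ-nat

  T₁π₂∘τ : ∀ {X Y} → T₁ π₂ ∘ τ {X} {Y} ≈ π₂
  T₁π₂∘τ = begin
    T₁ π₂ ∘ τ                        ≈⟨ *-resp-≈ (refl⟩∘⟨ ≈.sym π₂∘!⁂id) ⟩∘⟨refl ⟩
    T₁ (π₂ ∘ (! ⁂ id)) ∘ τ           ≈⟨ ≈.sym T₁-∘ ⟩∘⟨refl ⟩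
    (T₁ π₂ ∘ T₁ (! ⁂ id)) ∘ τ        ≈⟨ ≈.trans assoc (refl⟩∘⟨ ≈.sym τ-natˡ) ⟩
    T₁ π₂ ∘ (τ ∘ (! ⁂ id))           ≈⟨ ≈.trans sym-assoc (τ-unit ⟩∘⟨refl) ⟩
    π₂ ∘ (! ⁂ id)                    ≈⟨ π₂∘!⁂id ⟩
    π₂                               ∎
    where
    π₂∘!⁂id : ∀ {X Y} → π₂ ∘ (! {X} ⁂ id {Y}) ≈ π₂
    π₂∘!⁂id = ≈.trans project₂ identityˡ

  bind-ret : ∀ {Γ X Y} {u : Hom X Y} {t : Hom Γ (T₀ X)} →
             (η ∘ (u ∘ π₂)) * ∘ τ ∘ ⟨ id , t ⟩ ≈ T₁ u ∘ t
  bind-ret {u = u} {t} = begin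
    (η ∘ (u ∘ π₂)) * ∘ τ ∘ ⟨ id , t ⟩     ≈⟨ *-resp-≈ (≈.trans sym-assoc (≈.sym *∘η)) ⟩∘⟨refl ⟩
    (T₁ u ∘ (η ∘ π₂)) * ∘ τ ∘ ⟨ id , t ⟩  ≈⟨ ≈.sym ** ⟩∘⟨refl ⟩
    (T₁ u ∘ T₁ π₂) ∘ τ ∘ ⟨ id , t ⟩       ≈⟨ ≈.trans assoc (refl⟩∘⟨ ≈.trans sym-assoc (T₁π₂∘τ ⟩∘⟨refl)) ⟩
    T₁ u ∘ π₂ ∘ ⟨ id , t ⟩                ≈⟨ refl⟩∘⟨ project₂ ⟩
    T₁ u ∘ t                              ∎

  T₁⊞id-cancel : ∀ {V X Y Z} {h : Hom Y X} {u : Hom X Y} {f : Hom V (T₀ (X +₀ Z))} →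
                 h ∘ u ≈ id → T₁ (h ⊞ id) ∘ (T₁ (u ⊞ id) ∘ f) ≈ f
  T₁⊞id-cancel h∘u≈id = ≈.trans sym-assoc (≈.trans (≈.trans T₁-∘ (≈.trans
    (*-resp-≈ (refl⟩∘⟨ ≈.trans ⊞∘⊞ (≈.trans (⊞-cong₂ h∘u≈id identityˡ) id⊞id))) T₁-id) ⟩∘⟨refl) identityˡ)

  coit-cong : ∀ {Z X} {c c′ : Hom Z (T₀ (Z +₀ X))} → c ≈ c′ → coit c ≈ coit c′
  coit-cong p = coit-unique (≈.trans coit-hom (refl⟩∘⟨ p))

  coit-outR : ∀ {X} → coit (outR {X}) ≈ id
  coit-outR = ≈.sym (coit-unique (≈.trans identityʳ
    (≈.sym (≈.trans ((≈.trans (*-resp-≈ (refl⟩∘⟨ id⊞id)) T₁-id) ⟩∘⟨refl) identityˡ))))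

  coit-fusion : ∀ {Y Z X X′} {c : Hom Z (T₀ (Z +₀ X))} {d : Hom Y (T₀ (Y +₀ X′))}
                {u : Hom Y Z} {v : Hom X′ X} →
                c ∘ u ≈ T₁ (u ⊞ v) ∘ d → coit c ∘ u ≈ coit (T₁ (id ⊞ v) ∘ d)
  coit-fusion {c = c} {d} {u} {v} p = coit-unique (begin
    outR ∘ (coit c ∘ u)                        ≈⟨ ≈.trans sym-assoc (coit-hom ⟩∘⟨refl) ⟩
    (T₁ (coit c ⊞ id) ∘ c) ∘ u                 ≈⟨ ≈.trans assoc (refl⟩∘⟨ p) ⟩
    T₁ (coit c ⊞ id) ∘ (T₁ (u ⊞ v) ∘ d)        ≈⟨ ≈.trans sym-assoc (T₁-∘ ⟩∘⟨refl) ⟩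
    T₁ ((coit c ⊞ id) ∘ (u ⊞ v)) ∘ d           ≈⟨ *-resp-≈ (refl⟩∘⟨ split) ⟩∘⟨refl ⟩
    T₁ (((coit c ∘ u) ⊞ id) ∘ (id ⊞ v)) ∘ d    ≈⟨ ≈.trans (≈.sym T₁-∘ ⟩∘⟨refl) assoc ⟩
    T₁ ((coit c ∘ u) ⊞ id) ∘ (T₁ (id ⊞ v) ∘ d) ∎)
    where
    split : (coit c ⊞ id) ∘ (u ⊞ v) ≈ ((coit c ∘ u) ⊞ id) ∘ (id ⊞ v)
    split = ≈.trans ⊞∘⊞ (≈.trans (⊞-cong₂ (≈.sym identityʳ) (≈.trans identityˡ (≈.sym identityˡ)))
                                 (≈.sym ⊞∘⊞))

  Rmap∘coit : ∀ {Y X X′} {d : Hom Y (T₀ (Y +₀ X′))} {v : Hom X′ X} →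
              Rmap v ∘ coit d ≈ coit (T₁ (id ⊞ v) ∘ d)
  Rmap∘coit {d = d} {v} = coit-unique (begin
    outR ∘ (Rmap v ∘ coit d)                                      ≈⟨ ≈.trans sym-assoc (coit-hom ⟩∘⟨refl) ⟩
    (T₁ (Rmap v ⊞ id) ∘ (T₁ (id ⊞ v) ∘ outR)) ∘ coit d            ≈⟨ ≈.trans assoc (refl⟩∘⟨ ≈.trans assoc (refl⟩∘⟨ coit-hom)) ⟩
    T₁ (Rmap v ⊞ id) ∘ (T₁ (id ⊞ v) ∘ (T₁ (coit d ⊞ id) ∘ d))     ≈⟨ ≈.trans (refl⟩∘⟨ ≈.trans sym-assoc (T₁-∘ ⟩∘⟨refl))
                                                                      (≈.trans sym-assoc (T₁-∘ ⟩∘⟨refl)) ⟩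
    T₁ ((Rmap v ⊞ id) ∘ ((id ⊞ v) ∘ (coit d ⊞ id))) ∘ d          ≈⟨ *-resp-≈ (refl⟩∘⟨ swap) ⟩∘⟨refl ⟩
    T₁ (((Rmap v ∘ coit d) ⊞ id) ∘ (id ⊞ v)) ∘ d                 ≈⟨ ≈.trans (≈.sym T₁-∘ ⟩∘⟨refl) assoc ⟩
    T₁ ((Rmap v ∘ coit d) ⊞ id) ∘ (T₁ (id ⊞ v) ∘ d)              ∎)
    where
    swap : (Rmap v ⊞ id) ∘ ((id ⊞ v) ∘ (coit d ⊞ id)) ≈ ((Rmap v ∘ coit d) ⊞ id) ∘ (id ⊞ v)
    swap = ≈.trans (refl⟩∘⟨ ⊞∘⊞) (≈.trans ⊞∘⊞ (≈.trans
      (⊞-cong₂ (≈.trans (refl⟩∘⟨ identityˡ) (≈.sym identityʳ)) (refl⟩∘⟨ identityʳ)) (≈.sym ⊞∘⊞)))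

  coit-fusion-Rmap : ∀ {Y Z X X′} {c : Hom Z (T₀ (Z +₀ X))} {d : Hom Y (T₀ (Y +₀ X′))}
                     {u : Hom Y Z} {v : Hom X′ X} →
                     c ∘ u ≈ T₁ (u ⊞ v) ∘ d → coit c ∘ u ≈ Rmap v ∘ coit d
  coit-fusion-Rmap p = ≈.trans (coit-fusion p) (≈.sym Rmap∘coit)

  Rmap-cong : ∀ {X Y} {f g : Hom X Y} → f ≈ g → Rmap f ≈ Rmap g
  Rmap-cong p = coit-cong (*-resp-≈ (refl⟩∘⟨ []-cong₂ ≈.refl (refl⟩∘⟨ p)) ⟩∘⟨refl)

  Rmap∘Rmap : ∀ {X Y Z} {f : Hom Y Z} {g : Hom X Y} → Rmap f ∘ Rmap g ≈ Rmap (f ∘ g)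
  Rmap∘Rmap = ≈.trans Rmap∘coit (coit-cong (≈.trans sym-assoc (≈.trans T₁-∘
     (*-resp-≈ (refl⟩∘⟨ ≈.trans ⊞∘⊞ ([]-cong₂ (refl⟩∘⟨ identityˡ) ≈.refl))) ⟩∘⟨refl)))

  unfoldCoalg : ∀ {Γ A B} → Hom (Γ ×₀ A) (T₀ (A +₀ B)) → Hom (Γ ×₀ A) (T₀ ((Γ ×₀ A) +₀ (Γ ×₀ B)))
  unfoldCoalg q = (η ∘ dist) * ∘ τ ∘ ⟨ π₁ , q ⟩

  unfoldCoalg-natˡ : ∀ {Γ Δ A B} {f : Hom Δ Γ} {q : Hom (Γ ×₀ A) (T₀ (A +₀ B))} →
    unfoldCoalg q ∘ (f ⁂ id) ≈ T₁ ((f ⁂ id) ⊞ (f ⁂ id)) ∘ unfoldCoalg (q ∘ (f ⁂ id))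
  unfoldCoalg-natˡ {f = f} {q} = begin
    ((η ∘ dist) * ∘ τ ∘ ⟨ π₁ , q ⟩) ∘ (f ⁂ id)                   ≈⟨ ≈.trans assoc (refl⟩∘⟨ assoc) ⟩
    (η ∘ dist) * ∘ τ ∘ (⟨ π₁ , q ⟩ ∘ (f ⁂ id))                   ≈⟨ refl⟩∘⟨ refl⟩∘⟨ ⟨π₁,q⟩∘f⁂id ⟩
    (η ∘ dist) * ∘ τ ∘ ((f ⁂ id) ∘ ⟨ π₁ , q′ ⟩)                  ≈⟨ refl⟩∘⟨ ≈.trans sym-assoc (τ-natˡ ⟩∘⟨refl) ⟩
    (η ∘ dist) * ∘ ((T₁ (f ⁂ id) ∘ τ) ∘ ⟨ π₁ , q′ ⟩)             ≈⟨ ≈.trans (refl⟩∘⟨ assoc) sym-assoc ⟩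
    (T₁ dist ∘ T₁ (f ⁂ id)) ∘ (τ ∘ ⟨ π₁ , q′ ⟩)                  ≈⟨ ≈.trans T₁-∘ (≈.trans (*-resp-≈ (refl⟩∘⟨ dist-natˡ))
                                                                       (≈.sym T₁-∘)) ⟩∘⟨refl ⟩
    (T₁ ((f ⁂ id) ⊞ (f ⁂ id)) ∘ T₁ dist) ∘ (τ ∘ ⟨ π₁ , q′ ⟩)     ≈⟨ assoc ⟩
    T₁ ((f ⁂ id) ⊞ (f ⁂ id)) ∘ ((η ∘ dist) * ∘ τ ∘ ⟨ π₁ , q′ ⟩)  ∎
    where
    q′ = q ∘ (f ⁂ id)
    ⟨π₁,q⟩∘f⁂id : ⟨ π₁ , q ⟩ ∘ (f ⁂ id) ≈ (f ⁂ id) ∘ ⟨ π₁ , q′ ⟩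
    ⟨π₁,q⟩∘f⁂id = ≈.trans ⟨⟩∘ (≈.trans (⟨⟩-cong₂ project₁ (≈.sym identityˡ)) (≈.sym ⁂∘⟨⟩))

  Rmap-π₂∘coit-unfoldCoalg : ∀ {Γ Z X} {q : Hom (Γ ×₀ Z) (T₀ (Z +₀ X))} {c : Hom Z (T₀ (Z +₀ X))} →
    q ≈ c ∘ π₂ → Rmap π₂ ∘ coit (unfoldCoalg q) ≈ coit c ∘ π₂
  Rmap-π₂∘coit-unfoldCoalg {q = q} {c} q≈c∘π₂ = ≈.sym (coit-fusion-Rmap (begin
    c ∘ π₂                                         ≈⟨ ≈.sym q≈c∘π₂ ⟩
    q                                              ≈⟨ ≈.sym project₂ ⟩
    π₂ ∘ ⟨ π₁ , q ⟩                                ≈⟨ ≈.sym T₁π₂∘τ ⟩∘⟨refl ⟩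
    (T₁ π₂ ∘ τ) ∘ ⟨ π₁ , q ⟩                       ≈⟨ (*-resp-≈ (refl⟩∘⟨ ≈.sym π₂⊞π₂∘dist) ⟩∘⟨refl) ⟩∘⟨refl ⟩
    (T₁ ((π₂ ⊞ π₂) ∘ dist) ∘ τ) ∘ ⟨ π₁ , q ⟩       ≈⟨ (≈.sym T₁-∘ ⟩∘⟨refl) ⟩∘⟨refl ⟩
    ((T₁ (π₂ ⊞ π₂) ∘ T₁ dist) ∘ τ) ∘ ⟨ π₁ , q ⟩    ≈⟨ ≈.trans assoc (≈.trans assoc (refl⟩∘⟨ sym-assoc)) ⟩
    T₁ (π₂ ⊞ π₂) ∘ (T₁ dist ∘ τ) ∘ ⟨ π₁ , q ⟩      ≈⟨ refl⟩∘⟨ assoc ⟩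
    T₁ (π₂ ⊞ π₂) ∘ unfoldCoalg q                   ∎))

  injₙ : ∀ {n} {C : Fin (suc n) → Ty W} (j : Fin (suc n)) → Hom ⟦ C j ⟧ty ⟦ Sum C ⟧ty
  injₙ {zero}      zero    = id
  injₙ {suc n}     zero    = i₁
  injₙ {suc n} {C} (suc j) = i₂ ∘ injₙ {C = C ∘′ suc} j

  [_]ₙ : ∀ {n} {C : Fin (suc n) → Ty W} {Y} → ((j : Fin (suc n)) → Hom ⟦ C j ⟧ty Y) → Hom ⟦ Sum C ⟧ty Y
  [_]ₙ {zero}      fs = fs zero
  [_]ₙ {suc n} {C} fs = [ fs zero , [_]ₙ {C = C ∘′ suc} (λ j → fs (suc j)) ]

  []ₙ∘injₙ : ∀ {n} {C : Fin (suc n) → Ty W} {Y} (fs : (j : Fin (suc n)) → Hom ⟦ C j ⟧ty Y) j →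
             [_]ₙ {C = C} fs ∘ injₙ j ≈ fs j
  []ₙ∘injₙ {zero}      fs zero    = identityʳ
  []ₙ∘injₙ {suc n}     fs zero    = inject₁
  []ₙ∘injₙ {suc n} {C} fs (suc j) =
    ≈.trans sym-assoc (≈.trans (inject₂ ⟩∘⟨refl) ([]ₙ∘injₙ {C = C ∘′ suc} (λ j → fs (suc j)) j))

  +ₙ-ext : ∀ {n} {C : Fin (suc n) → Ty W} {Y} {f g : Hom ⟦ Sum C ⟧ty Y} →
           (∀ j → f ∘ injₙ {C = C} j ≈ g ∘ injₙ j) → f ≈ g
  +ₙ-ext {zero}      h = ≈.trans (≈.sym identityʳ) (≈.trans (h zero) identityʳ)
  +ₙ-ext {suc n} {C} h = +-ext (h zero)
    (+ₙ-ext {C = C ∘′ suc} (λ j → ≈.trans assoc (≈.trans (h (suc j)) sym-assoc)))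

  -- the maps  id ⁂ injₙ j  are jointly epic, by distributivity
  ⁂injₙ-ext : ∀ {n} {C : Fin (suc n) → Ty W} {X Y} {f g : Hom (X ×₀ ⟦ Sum C ⟧ty) Y} →
              (∀ j → f ∘ (id ⁂ injₙ {C = C} j) ≈ g ∘ (id ⁂ injₙ j)) → f ≈ g
  ⁂injₙ-ext {zero} h =
    ≈.trans (≈.sym (≈.trans (refl⟩∘⟨ id⁂id) identityʳ))
            (≈.trans (h zero) (≈.trans (refl⟩∘⟨ id⁂id) identityʳ))
  ⁂injₙ-ext {suc n} {C} {f = f} {g} h = cancel-dist⁻¹ (≈.trans ∘[] (≈.trans
    ([]-cong₂ (≈.trans (refl⟩∘⟨ id⁂i) (h zero)) (≈.trans (refl⟩∘⟨ id⁂i) on-i₂))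
    (≈.sym (≈.trans ∘[] ([]-cong₂ (refl⟩∘⟨ id⁂i) (refl⟩∘⟨ id⁂i))))))
    where
    id⁂i : ∀ {X Y Y′} {i : Hom Y Y′} → ⟨ π₁ , i ∘ π₂ ⟩ ≈ id {X} ⁂ i
    id⁂i = ⟨⟩-cong₂ (≈.sym identityˡ) ≈.refl
    id⁂∘ : ∀ {X Y Y′ Y″} {i : Hom Y′ Y″} {i′ : Hom Y Y′} → (id {X} ⁂ i) ∘ (id ⁂ i′) ≈ id ⁂ (i ∘ i′)
    id⁂∘ = ≈.trans ⁂∘⁂ (⟨⟩-cong₂ (identityˡ ⟩∘⟨refl) ≈.refl)
    on-i₂ : f ∘ (id ⁂ i₂) ≈ g ∘ (id ⁂ i₂)
    on-i₂ = ⁂injₙ-ext {C = C ∘′ suc} (λ j → ≈.trans assoc (≈.trans (refl⟩∘⟨ id⁂∘) (≈.trans (h (suc j))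
                                (≈.sym (≈.trans assoc (refl⟩∘⟨ id⁂∘))))))

injN : ∀ {S Γ n} {C : Fin (suc n) → Ty (Atom S)} (j : Fin (suc n)) → Tm S Γ (C j) → Tm S Γ (Sum C)
injN {n = zero}      zero    t = t
injN {n = suc n}     zero    t = inl t
injN {n = suc n} {C} (suc j) t = inr (injN {C = C ∘′ suc} j t)

module Interpretation {S : Sig} {o ℓ e : Level} (M : Model S o ℓ e) where
  open Model M
  open Categorical str

  ⟦_⟧ren : ∀ {Γ Δ} → Ren Γ Δ → Hom ⟦ Δ ⟧cx ⟦ Γ ⟧cx
  ⟦_⟧ren {ε}     ρ = !
  ⟦_⟧ren {Γ ▸ A} ρ = ⟨ ⟦ (λ x → ρ (there x)) ⟧ren , ⟦ ρ here ⟧var ⟩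

  ⟦var⟧∘⟦ren⟧ : ∀ {Γ Δ A} (ρ : Ren Γ Δ) (x : Γ ∋ A) → ⟦ x ⟧var ∘ ⟦ ρ ⟧ren ≈ ⟦ ρ x ⟧var
  ⟦var⟧∘⟦ren⟧ ρ here      = project₂
  ⟦var⟧∘⟦ren⟧ ρ (there x) = ≈.trans assoc (≈.trans (refl⟩∘⟨ project₁) (⟦var⟧∘⟦ren⟧ (λ y → ρ (there y)) x))

  ⟦there∘ren⟧ : ∀ {Γ Δ B} (ρ : Ren Γ Δ) → ⟦ (λ x → there {B = B} (ρ x)) ⟧ren ≈ ⟦ ρ ⟧ren ∘ π₁
  ⟦there∘ren⟧ {ε}     ρ = !-unique₂
  ⟦there∘ren⟧ {Γ ▸ A} ρ = ≈.trans (⟨⟩-cong₂ (⟦there∘ren⟧ (λ x → ρ (there x))) ≈.refl) (≈.sym ⟨⟩∘)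

  ⟦id⟧ren : ∀ {Γ} → ⟦ (λ {A} (x : Γ ∋ A) → x) ⟧ren ≈ id
  ⟦there⟧ren : ∀ {Γ B} → ⟦ there {Γ = Γ} {B = B} ⟧ren ≈ π₁

  ⟦id⟧ren {ε}     = ≈.sym (!-unique _)
  ⟦id⟧ren {Γ ▸ A} = ≈.trans (⟨⟩-cong₂ (⟦there⟧ren {Γ} {A}) ≈.refl) ×-η

  ⟦there⟧ren {Γ} = ≈.trans (⟦there∘ren⟧ {Γ} (λ x → x)) (≈.trans (⟦id⟧ren {Γ} ⟩∘⟨refl) identityˡ)

  ⟦lift⟧ren : ∀ {Γ Δ B} (ρ : Ren Γ Δ) → ⟦ lift {B = B} ρ ⟧ren ≈ ⟦ ρ ⟧ren ⁂ id
  ⟦lift⟧ren ρ = ⟨⟩-cong₂ (⟦there∘ren⟧ ρ) (≈.sym identityˡ)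

  ⟦ren⟧ : ∀ {Γ Δ A} (ρ : Ren Γ Δ) (t : Tm S Γ A) → ⟦ ren ρ t ⟧ ≈ ⟦ t ⟧ ∘ ⟦ ρ ⟧ren
  ⟦ren⟧ ρ (var x)      = ≈.sym (⟦var⟧∘⟦ren⟧ ρ x)
  ⟦ren⟧ ρ (app f t)    = ≈.trans (refl⟩∘⟨ ⟦ren⟧ ρ t) sym-assoc
  ⟦ren⟧ ρ ⋆            = !-unique₂
  ⟦ren⟧ ρ (pair t u)   = ≈.trans (⟨⟩-cong₂ (⟦ren⟧ ρ t) (⟦ren⟧ ρ u)) (≈.sym ⟨⟩∘)
  ⟦ren⟧ ρ (fst t)      = ≈.trans (refl⟩∘⟨ ⟦ren⟧ ρ t) sym-assoc
  ⟦ren⟧ ρ (snd t)      = ≈.trans (refl⟩∘⟨ ⟦ren⟧ ρ t) sym-assoc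
  ⟦ren⟧ ρ (inl t)      = ≈.trans (refl⟩∘⟨ ⟦ren⟧ ρ t) sym-assoc
  ⟦ren⟧ ρ (inr t)      = ≈.trans (refl⟩∘⟨ ⟦ren⟧ ρ t) sym-assoc
  ⟦ren⟧ ρ (ret t)      = ≈.trans (refl⟩∘⟨ ⟦ren⟧ ρ t) sym-assoc
  ⟦ren⟧ ρ (out t)      = ≈.trans (refl⟩∘⟨ ⟦ren⟧ ρ t) sym-assoc
  ⟦ren⟧ ρ ∅            = ≈.trans (refl⟩∘⟨ !-unique₂) sym-assoc
  ⟦ren⟧ ρ (t ⊹ u)      =
    ≈.trans (refl⟩∘⟨ ≈.trans (⟨⟩-cong₂ (⟦ren⟧ ρ t) (⟦ren⟧ ρ u)) (≈.sym ⟨⟩∘)) sym-assoc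
  ⟦ren⟧ ρ (case s t u) = begin
    [ ⟦ ren (lift ρ) t ⟧ , ⟦ ren (lift ρ) u ⟧ ] ∘ dist ∘ ⟨ id , ⟦ ren ρ s ⟧ ⟩
      ≈⟨ ∘-resp-≈ ([]-cong₂ (⟦ren-lift⟧ t) (⟦ren-lift⟧ u)) (refl⟩∘⟨ ⟨⟩-cong₂ ≈.refl (⟦ren⟧ ρ s)) ⟩
    [ ⟦ t ⟧ ∘ (f ⁂ id) , ⟦ u ⟧ ∘ (f ⁂ id) ] ∘ dist ∘ ⟨ id , ⟦ s ⟧ ∘ f ⟩    ≈⟨ ≈.sym []∘⊞ ⟩∘⟨refl ⟩
    ([ ⟦ t ⟧ , ⟦ u ⟧ ] ∘ ((f ⁂ id) ⊞ (f ⁂ id))) ∘ dist ∘ ⟨ id , ⟦ s ⟧ ∘ f ⟩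
      ≈⟨ ≈.trans assoc (refl⟩∘⟨ ≈.trans sym-assoc (≈.trans (≈.sym dist-natˡ ⟩∘⟨refl) assoc)) ⟩
    [ ⟦ t ⟧ , ⟦ u ⟧ ] ∘ dist ∘ ((f ⁂ id) ∘ ⟨ id , ⟦ s ⟧ ∘ f ⟩)             ≈⟨ refl⟩∘⟨ refl⟩∘⟨ ≈.sym ⟨id,⟩∘ ⟩
    [ ⟦ t ⟧ , ⟦ u ⟧ ] ∘ dist ∘ (⟨ id , ⟦ s ⟧ ⟩ ∘ f)                       ≈⟨ ≈.trans (refl⟩∘⟨ sym-assoc) sym-assoc ⟩
    ([ ⟦ t ⟧ , ⟦ u ⟧ ] ∘ dist ∘ ⟨ id , ⟦ s ⟧ ⟩) ∘ f                       ∎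
    where
    f = ⟦ ρ ⟧ren
    ⟦ren-lift⟧ : ∀ {A C} (v : Tm S (_ ▸ A) C) → ⟦ ren (lift ρ) v ⟧ ≈ ⟦ v ⟧ ∘ (f ⁂ id)
    ⟦ren-lift⟧ v = ≈.trans (⟦ren⟧ (lift ρ) v) (refl⟩∘⟨ ⟦lift⟧ren ρ)
  ⟦ren⟧ ρ (bind t u) = begin
    ⟦ ren (lift ρ) u ⟧ * ∘ τ ∘ ⟨ id , ⟦ ren ρ t ⟧ ⟩
      ≈⟨ ∘-resp-≈ (*-resp-≈ (≈.trans (⟦ren⟧ (lift ρ) u) (refl⟩∘⟨ ⟦lift⟧ren ρ)))
                  (refl⟩∘⟨ ⟨⟩-cong₂ ≈.refl (⟦ren⟧ ρ t)) ⟩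
    (⟦ u ⟧ ∘ (f ⁂ id)) * ∘ τ ∘ ⟨ id , ⟦ t ⟧ ∘ f ⟩        ≈⟨ ≈.sym *∘T₁ ⟩∘⟨refl ⟩
    (⟦ u ⟧ * ∘ T₁ (f ⁂ id)) ∘ τ ∘ ⟨ id , ⟦ t ⟧ ∘ f ⟩     ≈⟨ ≈.trans assoc (refl⟩∘⟨ ≈.trans sym-assoc
                                                           (≈.trans (≈.sym τ-natˡ ⟩∘⟨refl) assoc)) ⟩
    ⟦ u ⟧ * ∘ τ ∘ ((f ⁂ id) ∘ ⟨ id , ⟦ t ⟧ ∘ f ⟩)        ≈⟨ refl⟩∘⟨ refl⟩∘⟨ ≈.sym ⟨id,⟩∘ ⟩
    ⟦ u ⟧ * ∘ τ ∘ (⟨ id , ⟦ t ⟧ ⟩ ∘ f)                  ≈⟨ ≈.trans (refl⟩∘⟨ sym-assoc) sym-assoc ⟩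
    (⟦ u ⟧ * ∘ τ ∘ ⟨ id , ⟦ t ⟧ ⟩) ∘ f                  ∎
    where f = ⟦ ρ ⟧ren
  ⟦ren⟧ ρ (unfold t u) = ≈.sym (begin
    (Rmap π₂ ∘ coit (unfoldCoalg ⟦ u ⟧) ∘ ⟨ id , ⟦ t ⟧ ⟩) ∘ f
      ≈⟨ ≈.trans assoc (refl⟩∘⟨ ≈.trans assoc (refl⟩∘⟨ ⟨id,⟩∘)) ⟩
    Rmap π₂ ∘ coit (unfoldCoalg ⟦ u ⟧) ∘ ((f ⁂ id) ∘ ⟨ id , ⟦ t ⟧ ∘ f ⟩)
      ≈⟨ refl⟩∘⟨ ≈.trans sym-assoc (coit-fusion-Rmap unfoldCoalg-natˡ ⟩∘⟨refl) ⟩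
    Rmap π₂ ∘ ((Rmap (f ⁂ id) ∘ coit (unfoldCoalg (⟦ u ⟧ ∘ (f ⁂ id)))) ∘ ⟨ id , ⟦ t ⟧ ∘ f ⟩)
      ≈⟨ ≈.trans (refl⟩∘⟨ assoc) sym-assoc ⟩
    (Rmap π₂ ∘ Rmap (f ⁂ id)) ∘ coit (unfoldCoalg (⟦ u ⟧ ∘ (f ⁂ id))) ∘ ⟨ id , ⟦ t ⟧ ∘ f ⟩
      ≈⟨ ≈.trans Rmap∘Rmap (Rmap-cong (≈.trans project₂ identityˡ)) ⟩∘⟨refl ⟩
    Rmap π₂ ∘ coit (unfoldCoalg (⟦ u ⟧ ∘ (f ⁂ id))) ∘ ⟨ id , ⟦ t ⟧ ∘ f ⟩
      ≈⟨ refl⟩∘⟨ ∘-resp-≈ (coit-cong (refl⟩∘⟨ refl⟩∘⟨ ⟨⟩-cong₂ ≈.refl ⟦u⟧∘f⁂id))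
                          (⟨⟩-cong₂ ≈.refl (≈.sym (⟦ren⟧ ρ t))) ⟩
    Rmap π₂ ∘ coit (unfoldCoalg ⟦ ren (lift ρ) u ⟧) ∘ ⟨ id , ⟦ ren ρ t ⟧ ⟩   ∎)
    where
    f = ⟦ ρ ⟧ren
    ⟦u⟧∘f⁂id : ⟦ u ⟧ ∘ (f ⁂ id) ≈ ⟦ ren (lift ρ) u ⟧
    ⟦u⟧∘f⁂id = ≈.sym (≈.trans (⟦ren⟧ (lift ρ) u) (refl⟩∘⟨ ⟦lift⟧ren ρ))

  ⟦weaken⟧ : ∀ {Γ A B C} (t : Tm S (Γ ▸ A) C) → ⟦ ren (lift (there {B = B})) t ⟧ ≈ ⟦ t ⟧ ∘ (π₁ ⁂ id)
  ⟦weaken⟧ {Γ} {A} {B} t = ≈.trans (⟦ren⟧ (lift {B = A} (there {Γ = Γ} {B = B})) t)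
    (refl⟩∘⟨ ≈.trans (⟦lift⟧ren {B = A} (there {Γ = Γ} {B = B})) (⟨⟩-cong₂ (⟦there⟧ren {Γ} {B} ⟩∘⟨refl) ≈.refl))

  ⟦injN⟧ : ∀ {n Γ} {C : Fin (suc n) → Ty (Atom S)} (j : Fin (suc n)) (t : Tm S Γ (C j)) →
           ⟦ injN {C = C} j t ⟧ ≈ injₙ {C = C} j ∘ ⟦ t ⟧
  ⟦injN⟧ {zero}          zero    t = ≈.sym identityˡ
  ⟦injN⟧ {suc n}         zero    t = ≈.refl
  ⟦injN⟧ {suc n} {C = C} (suc j) t = ≈.trans (refl⟩∘⟨ ⟦injN⟧ {C = C ∘′ suc} j t) sym-assoc

  ⟦caseN⟧∘id⁂injₙ : ∀ {n Γ D} {C : Fin (suc n) → Ty (Atom S)} (bs : (j : Fin (suc n)) → Tm S (Γ ▸ C j) D) j →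
    ⟦ caseN {C = C} here (λ j → ren (lift there) (bs j)) ⟧ ∘ (id ⁂ injₙ {C = C} j) ≈ ⟦ bs j ⟧
  ⟦caseN⟧∘id⁂injₙ {zero} {Γ} {C = C} bs zero = begin
    ⟦ ren (here ↦) (ren (lift there) (bs zero)) ⟧ ∘ (id ⁂ id)
      ≈⟨ ≈.trans (⟦ren⟧ (here {Γ = Γ} {A = C zero} ↦) (ren (lift there) (bs zero)))
                 (⟦weaken⟧ (bs zero) ⟩∘⟨ ⟨⟩-cong₂ (⟦id⟧ren {Γ ▸ _}) ≈.refl) ⟩∘⟨ id⁂id ⟩
    ((⟦ bs zero ⟧ ∘ (π₁ ⁂ id)) ∘ ⟨ id , π₂ ⟩) ∘ id
      ≈⟨ ≈.trans identityʳ (≈.trans assoc (refl⟩∘⟨ ≈.trans (refl⟩∘⟨ ⟨⟩-cong₂ (≈.sym id⁂id) ≈.refl)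
                                                               π₁⁂id∘⟨id⁂f,π₂⟩)) ⟩
    ⟦ bs zero ⟧ ∘ id                                ≈⟨ identityʳ ⟩
    ⟦ bs zero ⟧                                     ∎
  ⟦caseN⟧∘id⁂injₙ {suc n} {C = C} bs zero = begin
    ([ ⟦ ren (lift there) (bs zero) ⟧ , ⟦ rest ⟧ ] ∘ dist ∘ ⟨ id , π₂ ⟩) ∘ (id ⁂ i₁)
      ≈⟨ ≈.trans assoc (refl⟩∘⟨ ≈.trans assoc (refl⟩∘⟨ ≈.trans ⟨⟩∘ (⟨⟩-cong₂ identityˡ project₂))) ⟩
    [ ⟦ ren (lift there) (bs zero) ⟧ , ⟦ rest ⟧ ] ∘ dist ∘ ⟨ id ⁂ i₁ , i₁ ∘ π₂ ⟩
      ≈⟨ refl⟩∘⟨ dist-i₁ ⟩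
    [ ⟦ ren (lift there) (bs zero) ⟧ , ⟦ rest ⟧ ] ∘ (i₁ ∘ ⟨ id ⁂ i₁ , π₂ ⟩)
      ≈⟨ ≈.trans sym-assoc (inject₁ ⟩∘⟨refl) ⟩
    ⟦ ren (lift there) (bs zero) ⟧ ∘ ⟨ id ⁂ i₁ , π₂ ⟩
      ≈⟨ ≈.trans (⟦weaken⟧ (bs zero) ⟩∘⟨refl) (≈.trans assoc (≈.trans (refl⟩∘⟨ π₁⁂id∘⟨id⁂f,π₂⟩) identityʳ)) ⟩
    ⟦ bs zero ⟧                                                         ∎
    where rest = caseN here (λ j → ren (lift there) (ren (lift there) (bs (suc j))))
  ⟦caseN⟧∘id⁂injₙ {suc n} {C = C} bs (suc j) = begin
    ([ ⟦ ren (lift there) (bs zero) ⟧ , ⟦ rest ⟧ ] ∘ dist ∘ ⟨ id , π₂ ⟩) ∘ (id ⁂ (i₂ ∘ ι))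
      ≈⟨ ≈.trans assoc (refl⟩∘⟨ ≈.trans assoc (refl⟩∘⟨ ≈.trans ⟨⟩∘ (⟨⟩-cong₂ identityˡ (≈.trans project₂ assoc)))) ⟩
    [ ⟦ ren (lift there) (bs zero) ⟧ , ⟦ rest ⟧ ] ∘ dist ∘ ⟨ id ⁂ (i₂ ∘ ι) , i₂ ∘ (ι ∘ π₂) ⟩
      ≈⟨ refl⟩∘⟨ dist-i₂ ⟩
    [ ⟦ ren (lift there) (bs zero) ⟧ , ⟦ rest ⟧ ] ∘ (i₂ ∘ ⟨ id ⁂ (i₂ ∘ ι) , ι ∘ π₂ ⟩)
      ≈⟨ ≈.trans sym-assoc (inject₂ ⟩∘⟨refl) ⟩
    ⟦ rest ⟧ ∘ ⟨ id ⁂ (i₂ ∘ ι) , ι ∘ π₂ ⟩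
      ≈⟨ refl⟩∘⟨ ≈.sym (≈.trans ⁂∘⟨⟩ (⟨⟩-cong₂ identityˡ ≈.refl)) ⟩
    ⟦ rest ⟧ ∘ ((id ⁂ ι) ∘ ⟨ id ⁂ (i₂ ∘ ι) , π₂ ⟩)
      ≈⟨ ≈.trans sym-assoc (⟦caseN⟧∘id⁂injₙ {C = C ∘′ suc} (λ j → ren (lift there) (bs (suc j))) j ⟩∘⟨refl) ⟩
    ⟦ ren (lift there) (bs (suc j)) ⟧ ∘ ⟨ id ⁂ (i₂ ∘ ι) , π₂ ⟩
      ≈⟨ ≈.trans (⟦weaken⟧ (bs (suc j)) ⟩∘⟨refl) (≈.trans assoc (≈.trans (refl⟩∘⟨ π₁⁂id∘⟨id⁂f,π₂⟩) identityʳ)) ⟩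
    ⟦ bs (suc j) ⟧                                                      ∎
    where
    rest = caseN here (λ j → ren (lift there) (ren (lift there) (bs (suc j))))
    ι = injₙ {C = C ∘′ suc} j

  module _ {k} {A B : Fin k → Ty (Atom S)} (g : (i : Fin k) → Hom ⟦ A i ⟧ty (R ⟦ B i ⟧ty)) where
    private module M⁺ = Model (extModel {A = A} {B = B} M g)

    ⟦emb-var⟧ : ∀ {Γ X} (x : Γ ∋ X) → M⁺.⟦ x ⟧var ≡ ⟦ x ⟧var
    ⟦emb-var⟧ here      = ≡.refl
    ⟦emb-var⟧ (there x) = ≡.cong (_∘ π₁) (⟦emb-var⟧ x)

    ⟦emb⟧ : ∀ {Γ X} (t : Tm S Γ X) → M⁺.⟦ emb t ⟧ ≡ ⟦ t ⟧
    ⟦emb⟧ (var x)      = ⟦emb-var⟧ x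
    ⟦emb⟧ (app f t)    = ≡.cong (fun f ∘_) (⟦emb⟧ t)
    ⟦emb⟧ ⋆            = ≡.refl
    ⟦emb⟧ (pair t u)   = ≡.cong₂ ⟨_,_⟩ (⟦emb⟧ t) (⟦emb⟧ u)
    ⟦emb⟧ (fst t)      = ≡.cong (π₁ ∘_) (⟦emb⟧ t)
    ⟦emb⟧ (snd t)      = ≡.cong (π₂ ∘_) (⟦emb⟧ t)
    ⟦emb⟧ (inl t)      = ≡.cong (i₁ ∘_) (⟦emb⟧ t)
    ⟦emb⟧ (inr t)      = ≡.cong (i₂ ∘_) (⟦emb⟧ t)
    ⟦emb⟧ (case s t u) =
      ≡.cong₂ (λ a b → a ∘ dist ∘ ⟨ id , b ⟩) (≡.cong₂ [_,_] (⟦emb⟧ t) (⟦emb⟧ u)) (⟦emb⟧ s)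
    ⟦emb⟧ (ret t)      = ≡.cong (η ∘_) (⟦emb⟧ t)
    ⟦emb⟧ (bind t u)   = ≡.cong₂ (λ a b → a * ∘ τ ∘ ⟨ id , b ⟩) (⟦emb⟧ u) (⟦emb⟧ t)
    ⟦emb⟧ ∅            = ≡.refl
    ⟦emb⟧ (t ⊹ u)      = ≡.cong₂ (λ a b → ϖ ∘ ⟨ a , b ⟩) (⟦emb⟧ t) (⟦emb⟧ u)
    ⟦emb⟧ (out t)      = ≡.cong (outR ∘_) (⟦emb⟧ t)
    ⟦emb⟧ (unfold t u) =
      ≡.cong₂ (λ a b → Rmap π₂ ∘ coit (unfoldCoalg a) ∘ ⟨ id , b ⟩) (⟦emb⟧ u) (⟦emb⟧ t)

module CallGraph (S : Sig) (k : ℕ) (A B : Fin k → Ty (Atom S))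
  (n : Fin k → ℕ) (C : (i : Fin k) → Fin (suc (n i)) → Ty (Atom S))
  (q : (i : Fin k) (j : Fin (suc (n i))) → Scheme.Branch S k A B i (C i j)) where
  open Scheme S k A B

  Calls : ∀ {i D} → Branch i D → Fin k → Set
  Calls (plain _)     m = ⊥
  Calls (call m′ _ _) m = m′ ≡ m

  calls? : ∀ {i D} (b : Branch i D) m → Dec (Calls b m)
  calls? (plain _)     m = no λ ()
  calls? (call m′ _ _) m = m′ ≟ m

  Calls⇒B≡ : ∀ {i D} {b : Branch i D} {m} → Calls b m → B m ≡ B i
  Calls⇒B≡ {b = call _ _ eB} refl = eB

  infix 4 _⟶_ _⟶⋆_

  _⟶_ : Fin k → Fin k → Set
  i ⟶ m = ∃[ j ] Calls (q i j) m

  _⟶?_ : ∀ i m → Dec (i ⟶ m)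
  i ⟶? m = any? λ j → calls? (q i j) m

  _⟶⋆_ : Fin k → Fin k → Set
  _⟶⋆_ = Star _⟶_

  ⟶⋆⇒B≡ : ∀ {i m} → i ⟶⋆ m → B m ≡ B i
  ⟶⋆⇒B≡ []⋆              = refl
  ⟶⋆⇒B≡ ((_ , c) ◅ path) = trans (⟶⋆⇒B≡ path) (Calls⇒B≡ c)

  -- the equations of the marked fₘ only involve marked symbols and have
  -- result type X, so they can share one coalgebra
  record Marking (X : Ty (Atom S)) : Set where
    field
      marked : Subset k
      typed  : ∀ {m} → m ∈ marked → B m ≡ X
      closed : ∀ {m m′} → m ∈ marked → m ⟶ m′ → m′ ∈ marked

    closed⋆ : ∀ {m m′} → m ∈ marked → m ⟶⋆ m′ → m′ ∈ marked
    closed⋆ m∈ []⋆           = m∈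
    closed⋆ m∈ (step ◅ path) = closed⋆ (closed m∈ step) path

  Leaks : Subset k → Set
  Leaks p = ∃[ m ] ∃[ m′ ] (m ∈ p × m ⟶ m′ × m′ ∉ p)

  leaks? : ∀ p → Dec (Leaks p)
  leaks? p = any? λ m → any? λ m′ → m ∈? p ×-dec m ⟶? m′ ×-dec ¬? (m′ ∈? p)

  record Closure (r : Fin k) : Set where
    field
      marked  : Subset k
      root    : r ∈ marked
      closed  : ∀ {m m′} → m ∈ marked → m ⟶ m′ → m′ ∈ marked
      reached : ∀ {m} → m ∈ marked → r ⟶⋆ m

  -- add missing callees one at a time; each step strictly enlarges the set
  grow : ∀ {r} (p : Subset k) → Acc _⊃_ p → r ∈ p → (∀ {m} → m ∈ p → r ⟶⋆ m) → Closure r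
  grow {r} p (acc rec) r∈p reached with leaks? p
  ... | no ¬leak = record { marked = p ; root = r∈p ; closed = closed ; reached = reached }
    where
    closed : ∀ {m m′} → m ∈ p → m ⟶ m′ → m′ ∈ p
    closed {m} {m′} m∈p m⟶m′ = decidable-stable (m′ ∈? p) λ m′∉p → ¬leak (m , m′ , m∈p , m⟶m′ , m′∉p)
  ... | yes (m , m′ , m∈p , m⟶m′ , m′∉p) =
    grow p′ (rec p′⊃p) (q⊆p∪q ⁅ m′ ⁆ p r∈p) reached′
    where
    p′ = ⁅ m′ ⁆ ∪ p
    m′∈p′ : m′ ∈ p′
    m′∈p′ = x∈p∪q⁺ (inj₁ (x∈⁅x⁆ m′))
    p′⊃p : p′ ⊃ p
    p′⊃p = q⊆p∪q ⁅ m′ ⁆ p , m′ , m′∈p′ , m′∉p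
    reached′ : ∀ {x} → x ∈ p′ → r ⟶⋆ x
    reached′ {x} x∈p′ with x∈p∪q⁻ ⁅ m′ ⁆ p x∈p′
    ... | inj₂ x∈p = reached x∈p
    ... | inj₁ x∈⁅m′⁆ with x∈⁅y⁆⇒x≡y m′ x∈⁅m′⁆
    ...   | refl = reached m∈p ◅◅ (m⟶m′ ◅ []⋆)

  closure : (r : Fin k) → Closure r
  closure r = grow ⁅ r ⁆ (⊃-wellFounded ⁅ r ⁆) (x∈⁅x⁆ r) λ m∈⁅r⁆ → reach (x∈⁅y⁆⇒x≡y r m∈⁅r⁆)
    where
    reach : ∀ {m} → m ≡ r → r ⟶⋆ m
    reach refl = []⋆

  reachable : (r : Fin k) → Marking (B r)
  reachable r = record
    { marked = Closure.marked (closure r)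
    ; typed  = λ m∈ → ⟶⋆⇒B≡ (Closure.reached (closure r) m∈)
    ; closed = Closure.closed (closure r)
    }

  reachable-root : ∀ r → r ∈ Marking.marked (reachable r)
  reachable-root r = Closure.root (closure r)

  reachable-⊆ : ∀ {r m} → m ∈ Marking.marked (reachable r) →
                Marking.marked (reachable m) ⊆ Marking.marked (reachable r)
  reachable-⊆ {r} {m} m∈ x∈ = Marking.closed⋆ (reachable r) m∈ (Closure.reached (closure m) x∈)

module GuardedScheme (S : Sig) (k : ℕ) (A B : Fin k → Ty (Atom S))
  (n : Fin k → ℕ) (C : (i : Fin k) → Fin (suc (n i)) → Ty (Atom S))
  (p : (i : Fin k) → Tm S (ε ▸ A i) (T (Sum (C i))))
  (q : (i : Fin k) (j : Fin (suc (n i))) → Scheme.Branch S k A B i (C i j)) where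
  open Scheme S k A B
  open CallGraph S k A B n C q
  open Marking

  State : Ty (Atom S) → Fin (suc k) → Ty (Atom S)
  State X zero    = Tν X
  State X (suc m) = A m

  Z : Ty (Atom S) → Ty (Atom S)
  Z X = Sum (State X)

  resume : ∀ {Γ X} → Tm S (Γ ▸ (Tν X ⊕ X)) (T (Z X ⊕ X))
  resume {X = X} = ret (case (var here) (inl (injN {C = State X} zero (var here))) (inr (var here)))

  stepBranch : ∀ {m D} → Branch m D → Tm S (ε ▸ A m ▸ D) (T (Z (B m) ⊕ B m))
  stepBranch (plain t)                = bind t resume
  stepBranch {m} {D} (call m′ eA eB) =
    ret (inl (injN {C = State (B m)} (suc m′) (var (subst (λ Y → (ε ▸ A m ▸ D) ∋ Y) (sym eA) here))))

  step : ∀ m → Tm S (ε ▸ A m) (T (Z (B m) ⊕ B m))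
  step m = bind (p m) (caseN here (λ j → ren (lift there) (stepBranch (q m j))))

  stepAs : ∀ {m X} → B m ≡ X → Tm S (ε ▸ A m) (T (Z X ⊕ X))
  stepAs {m} refl = step m

  module _ {X} (𝓜 : Marking X) where

    markedStep : ∀ {m} → Dec (m ∈ marked 𝓜) → Tm S (ε ▸ A m) (T (Z X ⊕ X))
    markedStep (yes m∈) = stepAs (typed 𝓜 m∈)
    markedStep (no _)   = ∅

    component : (j : Fin (suc k)) → Tm S (ε ▸ State X j) (T (Z X ⊕ X))
    component zero    = bind (out (var here)) resume
    component (suc m) = markedStep (m ∈? marked 𝓜)

    coalgebra : Tm S (ε ▸ Z X) (T (Z X ⊕ X))
    coalgebra = caseN here (λ j → ren (lift there) (component j))

    markedStep-marked : ∀ {m} (d : Dec (m ∈ marked 𝓜)) (m∈ : m ∈ marked 𝓜) →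
                        markedStep d ≡ stepAs (typed 𝓜 m∈)
    markedStep-marked (yes m∈′) m∈ = ≡.cong stepAs (uip (typed 𝓜 m∈′) (typed 𝓜 m∈))
    markedStep-marked (no m∉)   m∈ = ⊥-elim (m∉ m∈)

  solution : (i : Fin k) → Tm S (ε ▸ A i) (Tν (B i))
  solution i = unfold (injN {C = State (B i)} (suc i) (var here)) (ren (lift there) (coalgebra (reachable i)))

  module Semantics {o ℓ e : Level} (M : Model S o ℓ e) where
    open Model M
    open Categorical str
    open Interpretation M

    Family : Set ℓ
    Family = (i : Fin k) → Hom ⟦ A i ⟧ty (R ⟦ B i ⟧ty)

    SolvesAt : Family → Fin k → Set e
    SolvesAt g m = outR ∘ g m ≈ Model.⟦_⟧₁ (extModel {A = A} {B = B} M g) (rhs n C p q m)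

    Solves⇔SolvesAt : ∀ g → Solves M n C p q g ⇔ (∀ m → SolvesAt g m)
    Solves⇔SolvesAt g = mk⇔
      (λ sol m → ≈.trans (≈.sym (≈.trans assoc (refl⟩∘⟨ ≈.trans assoc (≈.trans (refl⟩∘⟨ project₂) identityʳ))))
                         (sol m ⟩∘⟨refl))
      (λ sol m → ≈.trans sym-assoc (≈.trans (sol m ⟩∘⟨refl) (≈.trans assoc (≈.trans (refl⟩∘⟨ ⟨!,id⟩∘π₂) identityʳ))))

    castR : ∀ {V Y Y′} → Y ≡ Y′ → Hom V (R ⟦ Y ⟧ty) → Hom V (R ⟦ Y′ ⟧ty)
    castR refl f = f

    castR-cong : ∀ {V Y Y′} (pr : Y ≡ Y′) {f f′ : Hom V (R ⟦ Y ⟧ty)} → f ≈ f′ → castR pr f ≈ castR pr f′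
    castR-cong refl f≈f′ = f≈f′

    castR-cancel : ∀ {V Y Y′} (pr : Y ≡ Y′) {f f′ : Hom V (R ⟦ Y ⟧ty)} → castR pr f ≈ castR pr f′ → f ≈ f′
    castR-cancel refl f≈f′ = f≈f′

    castR-castR-sym : ∀ {V Y Y′} (pr : Y ≡ Y′) (f : Hom V (R ⟦ Y′ ⟧ty)) → castR pr (castR (sym pr) f) ≡ f
    castR-castR-sym refl f = refl

    injZ : ∀ {X} (j : Fin (suc k)) → Hom ⟦ State X j ⟧ty ⟦ Z X ⟧ty
    injZ {X} = injₙ {C = State X}

    ⟦bind-resume⟧ : ∀ {Γ X} (t : Tm S Γ (T (Tν X ⊕ X))) →
                    ⟦ bind t resume ⟧ ≈ T₁ (injZ zero ⊞ id) ∘ ⟦ t ⟧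
    ⟦bind-resume⟧ {X = X} t = ≈.trans (*-resp-≈ (refl⟩∘⟨ relabel) ⟩∘⟨refl) bind-ret
      where
      relabel : [ i₁ ∘ ⟦ injN {C = State X} zero (var here) ⟧ , i₂ ∘ π₂ ] ∘ dist ∘ ⟨ id , π₂ ⟩
                ≈ (injZ zero ⊞ id) ∘ π₂
      relabel = begin
        [ i₁ ∘ ⟦ injN {C = State X} zero (var here) ⟧ , i₂ ∘ π₂ ] ∘ dist ∘ ⟨ id , π₂ ⟩
          ≈⟨ ≈.trans ([]-cong₂ (refl⟩∘⟨ ⟦injN⟧ {C = State X} zero (var here)) (refl⟩∘⟨ ≈.sym identityˡ))
                     ([]-cong₂ sym-assoc sym-assoc) ⟩∘⟨refl ⟩
        [ (i₁ ∘ injZ zero) ∘ π₂ , (i₂ ∘ id) ∘ π₂ ] ∘ dist ∘ ⟨ id , π₂ ⟩  ≈⟨ ≈.sym []∘⊞ ⟩∘⟨refl ⟩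
        ((injZ zero ⊞ id) ∘ (π₂ ⊞ π₂)) ∘ dist ∘ ⟨ id , π₂ ⟩              ≈⟨ ≈.trans assoc (refl⟩∘⟨ ≈.trans sym-assoc
                                                                               (π₂⊞π₂∘dist ⟩∘⟨refl)) ⟩
        (injZ zero ⊞ id) ∘ π₂ ∘ ⟨ id , π₂ ⟩                              ≈⟨ refl⟩∘⟨ project₂ ⟩
        (injZ zero ⊞ id) ∘ π₂                                            ∎

    module WithFamily (g : Family) where
      private module M⁺ = Model (extModel {A = A} {B = B} M g)
      private module I⁺ = Interpretation (extModel {A = A} {B = B} M g)

      ⟦call⟧ : ∀ {Γ m′ Y V} (eB : B m′ ≡ Y) (v : Γ ∋ A m′) →
        M⁺.⟦ subst (λ X → Tm S⁺ Γ (T (Tν X ⊕ V))) eB (ret (inl (app (inj₂ m′) (var v)))) ⟧ ≈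
        η ∘ (i₁ ∘ (castR eB (g m′) ∘ ⟦ v ⟧var))
      ⟦call⟧ refl v = refl⟩∘⟨ refl⟩∘⟨ refl⟩∘⟨ ≈.reflexive (⟦emb-var⟧ g v)

      module _ {m} (h : Hom ⟦ Z (B m) ⟧ty (R ⟦ B m ⟧ty)) (h∘inj₀ : h ∘ injZ zero ≈ id)
               (agree : ∀ {j m′} (c : Calls (q m j) m′) → h ∘ injZ (suc m′) ≈ castR (Calls⇒B≡ c) (g m′)) where

        stepBranch-sound : ∀ {j} → T₁ (h ⊞ id) ∘ ⟦ stepBranch (q m j) ⟧ ≈ M⁺.⟦ branch (q m j) ⟧
        stepBranch-sound {j} with q m j | agree {j}
        ... | plain t | _ = begin
          T₁ (h ⊞ id) ∘ ⟦ bind t resume ⟧   ≈⟨ ≈.trans (refl⟩∘⟨ ⟦bind-resume⟧ t) (T₁⊞id-cancel h∘inj₀) ⟩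
          ⟦ t ⟧                            ≈⟨ ≈.reflexive (sym (⟦emb⟧ g t)) ⟩
          M⁺.⟦ emb t ⟧                     ∎
        ... | call m′ eA eB | agree′ = begin
          T₁ (h ⊞ id) ∘ (η ∘ (i₁ ∘ ⟦ injN {C = State (B m)} (suc m′) (var v) ⟧))
            ≈⟨ ≈.trans *∘η (≈.trans assoc (refl⟩∘⟨ ≈.trans sym-assoc (inject₁ ⟩∘⟨refl))) ⟩
          η ∘ ((i₁ ∘ h) ∘ ⟦ injN {C = State (B m)} (suc m′) (var v) ⟧)
            ≈⟨ refl⟩∘⟨ ≈.trans assoc (refl⟩∘⟨ ≈.trans (refl⟩∘⟨ ⟦injN⟧ {C = State (B m)} (suc m′) (var v))
                                                     (≈.trans sym-assoc (agree′ refl ⟩∘⟨refl))) ⟩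
          η ∘ (i₁ ∘ (castR eB (g m′) ∘ ⟦ v ⟧var))                   ≈⟨ ≈.sym (⟦call⟧ eB v) ⟩
          M⁺.⟦ branch (call m′ eA eB) ⟧                             ∎
          where v = subst (λ Y → (ε ▸ A m ▸ _) ∋ Y) (sym eA) here

        step-sound : T₁ (h ⊞ id) ∘ ⟦ step m ⟧ ≈ M⁺.⟦ rhs n C p q m ⟧
        step-sound = ≈.trans *∘* (*-resp-≈ cases ⟩∘⟨ refl⟩∘⟨ ⟨⟩-cong₂ ≈.refl (≈.reflexive (sym (⟦emb⟧ g (p m)))))
          where
          stepCases = caseN here (λ j → ren (lift there) (stepBranch (q m j)))
          rhsCases  = caseN here (λ j → ren (lift there) (branch (q m j)))
          cases : T₁ (h ⊞ id) ∘ ⟦ stepCases ⟧ ≈ M⁺.⟦ rhsCases ⟧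
          cases = ⁂injₙ-ext {C = C m} λ j → begin
            (T₁ (h ⊞ id) ∘ ⟦ stepCases ⟧) ∘ (id ⁂ injₙ {C = C m} j)
              ≈⟨ ≈.trans assoc (refl⟩∘⟨ ⟦caseN⟧∘id⁂injₙ {C = C m} (λ j → stepBranch (q m j)) j) ⟩
            T₁ (h ⊞ id) ∘ ⟦ stepBranch (q m j) ⟧                     ≈⟨ stepBranch-sound ⟩
            M⁺.⟦ branch (q m j) ⟧                                   ≈⟨ ≈.sym (I⁺.⟦caseN⟧∘id⁂injₙ {C = C m} (λ j → branch (q m j)) j) ⟩
            M⁺.⟦ rhsCases ⟧ ∘ (id ⁂ injₙ {C = C m} j)               ∎

      solvesAt⇔ : ∀ {m X} (pr : B m ≡ X) (h : Hom ⟦ Z X ⟧ty (R ⟦ X ⟧ty)) → h ∘ injZ zero ≈ id →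
        (∀ {j m′} (c : Calls (q m j) m′) → h ∘ injZ (suc m′) ≈ castR (trans (Calls⇒B≡ c) pr) (g m′)) →
        SolvesAt g m ⇔ (outR ∘ castR pr (g m) ≈ T₁ (h ⊞ id) ∘ ⟦ stepAs pr ⟧₁)
      solvesAt⇔ {m} refl h h∘inj₀ agree = mk⇔ (λ s → ≈.trans s (≈.sym sound₁)) (λ s → ≈.trans s sound₁)
        where
        agree′ : ∀ {j m′} (c : Calls (q m j) m′) → h ∘ injZ (suc m′) ≈ castR (Calls⇒B≡ c) (g m′)
        agree′ c = ≈.trans (agree c) (≈.reflexive (≡.cong (λ e → castR e _) (trans-reflʳ (Calls⇒B≡ c))))
        sound₁ : T₁ (h ⊞ id) ∘ ⟦ step m ⟧₁ ≈ M⁺.⟦ rhs n C p q m ⟧₁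
        sound₁ = ≈.trans sym-assoc (step-sound h h∘inj₀ agree′ ⟩∘⟨refl)

    module _ {X} (𝓜 : Marking X) where
      private
        γ : Hom ⟦ Z X ⟧ty (T₀ (⟦ Z X ⟧ty +₀ ⟦ X ⟧ty))
        γ = ⟦ coalgebra 𝓜 ⟧₁

      behaviour : Hom ⟦ Z X ⟧ty (R ⟦ X ⟧ty)
      behaviour = coit γ

      γ∘injZ : ∀ j → γ ∘ injZ j ≈ ⟦ component 𝓜 j ⟧₁
      γ∘injZ j = begin
        (⟦ coalgebra 𝓜 ⟧ ∘ ⟨ ! , id ⟩) ∘ injZ j               ≈⟨ ≈.trans assoc (refl⟩∘⟨ ⟨!,id⟩∘) ⟩
        ⟦ coalgebra 𝓜 ⟧ ∘ ((id ⁂ injZ j) ∘ ⟨ ! , id ⟩)        ≈⟨ ≈.trans sym-assoc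
                                                                  (⟦caseN⟧∘id⁂injₙ {C = State X} (component 𝓜) j ⟩∘⟨refl) ⟩
        ⟦ component 𝓜 j ⟧ ∘ ⟨ ! , id ⟩                        ∎

      γ∘inj₀ : γ ∘ injZ zero ≈ T₁ (injZ zero ⊞ id) ∘ outR
      γ∘inj₀ = ≈.trans (γ∘injZ zero) (≈.trans (⟦bind-resume⟧ (out (var here)) ⟩∘⟨refl)
        (≈.trans assoc (refl⟩∘⟨ ≈.trans assoc (≈.trans (refl⟩∘⟨ project₂) identityʳ))))

      behaviour∘inj₀ : behaviour ∘ injZ zero ≈ id
      behaviour∘inj₀ = ≈.trans (coit-fusion γ∘inj₀)
        (≈.trans (coit-cong (≈.trans (≈.trans (*-resp-≈ (refl⟩∘⟨ id⊞id)) T₁-id ⟩∘⟨refl) identityˡ)) coit-outR)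

      canonicalAt : ∀ m → Dec (m ∈ marked 𝓜) → Hom ⟦ A m ⟧ty (R ⟦ B m ⟧ty)
      canonicalAt m (yes m∈) = castR (sym (typed 𝓜 m∈)) (behaviour ∘ injZ (suc m))
      canonicalAt m (no _)   = coit (δ ∘ !)

      -- off the marking the value is irrelevant; the deadlocked process is a choice
      canonical : Family
      canonical m = canonicalAt m (m ∈? marked 𝓜)

      castR-canonical : ∀ {m} → m ∈ marked 𝓜 → (pr : B m ≡ X) → castR pr (canonical m) ≡ behaviour ∘ injZ (suc m)
      castR-canonical {m} m∈ pr with m ∈? marked 𝓜
      ... | yes m∈′ rewrite uip (typed 𝓜 m∈′) pr = castR-castR-sym pr _
      ... | no m∉   = ⊥-elim (m∉ m∈)

      canonical-unique : ∀ g → (∀ {m} → m ∈ marked 𝓜 → SolvesAt g m) → ∀ {m} → m ∈ marked 𝓜 → g m ≈ canonical m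
      canonical-unique g solves {m} m∈ = castR-cancel pr (begin
        castR pr (g m)                   ≈⟨ ≈.reflexive (sym (hAt-marked (m ∈? marked 𝓜) m∈ pr)) ⟩
        hAt m (m ∈? marked 𝓜)            ≈⟨ ≈.sym ([]ₙ∘injₙ {C = State X} hComponent (suc m)) ⟩
        h ∘ injZ (suc m)                 ≈⟨ coit-unique h-coalgebra ⟩∘⟨refl ⟩
        behaviour ∘ injZ (suc m)         ≈⟨ ≈.reflexive (sym (castR-canonical m∈ pr)) ⟩
        castR pr (canonical m)           ∎)
        where
        open WithFamily g
        pr = typed 𝓜 m∈

        hAt : ∀ m → Dec (m ∈ marked 𝓜) → Hom ⟦ A m ⟧ty (R ⟦ X ⟧ty)
        hAt m (yes m∈) = castR (typed 𝓜 m∈) (g m)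
        hAt m (no _)   = behaviour ∘ injZ (suc m)

        hComponent : (j : Fin (suc k)) → Hom ⟦ State X j ⟧ty (R ⟦ X ⟧ty)
        hComponent zero    = id
        hComponent (suc m) = hAt m (m ∈? marked 𝓜)

        -- built from g, and a coalgebra morphism into R X, hence equal to the behaviour
        h : Hom ⟦ Z X ⟧ty (R ⟦ X ⟧ty)
        h = [_]ₙ {C = State X} hComponent

        hAt-marked : ∀ {m} (d : Dec (m ∈ marked 𝓜)) → m ∈ marked 𝓜 → (pr : B m ≡ X) → hAt m d ≡ castR pr (g m)
        hAt-marked (yes m∈′) _  pr = ≡.cong (λ e → castR e _) (uip (typed 𝓜 m∈′) pr)
        hAt-marked (no m∉)   m∈ _  = ⊥-elim (m∉ m∈)

        h∘inj₀ : h ∘ injZ zero ≈ id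
        h∘inj₀ = []ₙ∘injₙ {C = State X} hComponent zero

        agree : ∀ {m} (m∈ : m ∈ marked 𝓜) → ∀ {j m′} (c : Calls (q m j) m′) →
                h ∘ injZ (suc m′) ≈ castR (trans (Calls⇒B≡ c) (typed 𝓜 m∈)) (g m′)
        agree m∈ {j} {m′} c = ≈.trans ([]ₙ∘injₙ {C = State X} hComponent (suc m′))
          (≈.reflexive (hAt-marked (m′ ∈? marked 𝓜) (closed 𝓜 m∈ (j , c)) _))

        deadlock : ∀ {m} (f : Hom ⟦ Z X ⟧ty (R ⟦ X ⟧ty)) (d : Dec (m ∈ marked 𝓜)) → m ∉ marked 𝓜 →
                   T₁ (f ⊞ id) ∘ ⟦ markedStep 𝓜 d ⟧₁ ≈ δ ∘ !
        deadlock f (yes m∈) m∉ = ⊥-elim (m∉ m∈)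
        deadlock f (no _)   _  = ≈.trans (refl⟩∘⟨ ≈.trans assoc (refl⟩∘⟨ !-unique₂)) *∘δ∘!

        hAt-coalgebra : ∀ m (d : Dec (m ∈ marked 𝓜)) → outR ∘ hAt m d ≈ T₁ (h ⊞ id) ∘ ⟦ markedStep 𝓜 d ⟧₁
        hAt-coalgebra m (yes m∈) = Equivalence.to (solvesAt⇔ (typed 𝓜 m∈) h h∘inj₀ (agree m∈)) (solves m∈)
        hAt-coalgebra m (no m∉)  = begin
          outR ∘ (behaviour ∘ injZ (suc m))                         ≈⟨ ≈.trans sym-assoc (coit-hom ⟩∘⟨refl) ⟩
          (T₁ (behaviour ⊞ id) ∘ γ) ∘ injZ (suc m)                  ≈⟨ ≈.trans assoc (refl⟩∘⟨ γ∘injZ (suc m)) ⟩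
          T₁ (behaviour ⊞ id) ∘ ⟦ markedStep 𝓜 (m ∈? marked 𝓜) ⟧₁   ≈⟨ deadlock behaviour (m ∈? marked 𝓜) m∉ ⟩
          δ ∘ !                                                     ≈⟨ ≈.sym (deadlock h (no m∉) m∉) ⟩
          T₁ (h ⊞ id) ∘ ⟦ markedStep 𝓜 (no m∉) ⟧₁                   ∎

        h-coalgebra : outR ∘ h ≈ T₁ (h ⊞ id) ∘ γ
        h-coalgebra = +ₙ-ext {C = State X} λ where
          zero → ≈.trans assoc (≈.trans (refl⟩∘⟨ h∘inj₀) (≈.trans identityʳ (≈.sym
                   (≈.trans assoc (≈.trans (refl⟩∘⟨ γ∘inj₀) (T₁⊞id-cancel h∘inj₀))))))
          (suc m) → ≈.trans assoc (≈.trans (refl⟩∘⟨ []ₙ∘injₙ {C = State X} hComponent (suc m))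
                      (≈.trans (hAt-coalgebra m (m ∈? marked 𝓜)) (≈.sym (≈.trans assoc (refl⟩∘⟨ γ∘injZ (suc m))))))

      canonical-solves : ∀ g → (∀ {m} → m ∈ marked 𝓜 → g m ≈ canonical m) → ∀ {m} → m ∈ marked 𝓜 → SolvesAt g m
      canonical-solves g g≈canonical {m} m∈ =
        Equivalence.from (solvesAt⇔ pr behaviour behaviour∘inj₀ agree) (begin
          outR ∘ castR pr (g m)                          ≈⟨ refl⟩∘⟨ onMarked m∈ pr ⟩
          outR ∘ (behaviour ∘ injZ (suc m))              ≈⟨ ≈.trans sym-assoc (coit-hom ⟩∘⟨refl) ⟩
          (T₁ (behaviour ⊞ id) ∘ γ) ∘ injZ (suc m)       ≈⟨ ≈.trans assoc (refl⟩∘⟨ γ∘injZ (suc m)) ⟩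
          T₁ (behaviour ⊞ id) ∘ ⟦ markedStep 𝓜 (m ∈? marked 𝓜) ⟧₁
            ≈⟨ ≈.reflexive (≡.cong (λ t → T₁ (behaviour ⊞ id) ∘ ⟦ t ⟧₁) (markedStep-marked 𝓜 (m ∈? marked 𝓜) m∈)) ⟩
          T₁ (behaviour ⊞ id) ∘ ⟦ stepAs pr ⟧₁           ∎)
        where
        open WithFamily g
        pr = typed 𝓜 m∈

        onMarked : ∀ {m} → m ∈ marked 𝓜 → (pr : B m ≡ X) → castR pr (g m) ≈ behaviour ∘ injZ (suc m)
        onMarked m∈ pr = ≈.trans (castR-cong pr (g≈canonical m∈)) (≈.reflexive (castR-canonical m∈ pr))

        agree : ∀ {j m′} (c : Calls (q m j) m′) → behaviour ∘ injZ (suc m′) ≈ castR (trans (Calls⇒B≡ c) pr) (g m′)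
        agree {j} c = ≈.sym (onMarked (closed 𝓜 m∈ (j , c)) _)

    ⟦solution⟧₁ : ∀ i → ⟦ solution i ⟧₁ ≈ canonical (reachable i) i
    ⟦solution⟧₁ i = begin
      (Rmap π₂ ∘ coit (unfoldCoalg ⟦ ren (lift there) coalg ⟧) ∘ ⟨ id , ⟦ start ⟧ ⟩) ∘ ⟨ ! , id ⟩
        ≈⟨ (≈.trans sym-assoc (Rmap-π₂∘coit-unfoldCoalg ⟦coalg⟧-weakened ⟩∘⟨refl) ⟩∘⟨refl) ⟩
      ((behaviour 𝓜 ∘ π₂) ∘ ⟨ id , ⟦ start ⟧ ⟩) ∘ ⟨ ! , id ⟩
        ≈⟨ ≈.trans assoc (≈.trans assoc (refl⟩∘⟨ ≈.trans sym-assoc (≈.trans (project₂ ⟩∘⟨refl)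
             (≈.trans (⟦injN⟧ {C = State (B i)} (suc i) (var here) ⟩∘⟨refl)
                      (≈.trans assoc (≈.trans (refl⟩∘⟨ project₂) identityʳ)))))) ⟩
      behaviour 𝓜 ∘ injZ (suc i)
        ≈⟨ ≈.reflexive (sym (castR-canonical 𝓜 (reachable-root i) refl)) ⟩
      canonical 𝓜 i ∎
      where
      𝓜 = reachable i
      coalg = coalgebra 𝓜
      start = injN {C = State (B i)} (suc i) (var here)
      ⟦coalg⟧-weakened : ⟦ ren (lift there) coalg ⟧ ≈ ⟦ coalg ⟧₁ ∘ π₂
      ⟦coalg⟧-weakened = ≈.trans (⟦weaken⟧ coalg) (≈.trans (refl⟩∘⟨ π₁⁂id≈) sym-assoc)
        where
        π₁⁂id≈ : π₁ ⁂ id ≈ ⟨ ! , id ⟩ ∘ π₂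
        π₁⁂id≈ = ×-ext (≈.trans project₁ (≈.sym (≈.trans sym-assoc (≈.trans (project₁ ⟩∘⟨refl) !-unique₂))))
                       (≈.trans project₂ (≈.sym (≈.trans sym-assoc (project₂ ⟩∘⟨refl))))

    solution-unique : ∀ g → Solves M n C p q g → ∀ i → g i ≈ ⟦ solution i ⟧₁
    solution-unique g sol i = ≈.trans
      (canonical-unique (reachable i) g (λ _ → Equivalence.to (Solves⇔SolvesAt g) sol _) (reachable-root i))
      (≈.sym (⟦solution⟧₁ i))

    -- the solution of fₘ agrees with the canonical family of every fᵢ that reaches it,
    -- since that family solves the equations reachable from m
    solution-solves : Solves M n C p q (λ i → ⟦ solution i ⟧₁)
    solution-solves = Equivalence.from (Solves⇔SolvesAt _) λ i →
      canonical-solves (reachable i) _ (agree i) (reachable-root i)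
      where
      agree : ∀ i {m} → m ∈ marked (reachable i) → ⟦ solution m ⟧₁ ≈ canonical (reachable i) m
      agree i {m} m∈ = ≈.trans (⟦solution⟧₁ m)
        (≈.sym (canonical-unique (reachable m) (canonical (reachable i))
          (λ s∈ → canonical-solves (reachable i) _ (λ _ → ≈.refl) (reachable-⊆ m∈ s∈)) (reachable-root m)))

theorem2 : (S : Sig) (k : ℕ) (A B : Fin k → Ty (Atom S))
           (n : Fin k → ℕ) (C : (i : Fin k) → Fin (suc (n i)) → Ty (Atom S))
           (p : (i : Fin k) → Tm S (ε ▸ A i) (T (Sum (C i))))
           (q : (i : Fin k) (j : Fin (suc (n i))) → Scheme.Branch S k A B i (C i j)) →
           ΣωSet ((i : Fin k) → Tm S (ε ▸ A i) (Tν (B i)))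
             (λ t → ∀ {o ℓ e} (M : Model S o ℓ e) →
                Solves M n C p q (λ i → Model.⟦_⟧₁ M (t i))
                × (∀ g → Solves M n C p q g → (i : Fin k) → Model._≈_ M (g i) (Model.⟦_⟧₁ M (t i))))
theorem2 S k A B n C p q = solution , λ M → solution-solves M , solution-unique M
  where open GuardedScheme S k A B n C p q
        open Semantics
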